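{- Let $G$ be a connected graph of order $n\geq 4$ and diameter $2$. Then \[ \xi^c(G)\le 2n^2-4n-2(n\bmod 2), \] with equality if and only if $G\simeq M_n$, or $n=5$ and $G\simeq H_1$.
   Context: All graphs are simple, finite, undirected. For a connected graph $G=(V,E)$, $\mathrm{dist}(u,v)$ is the number of edges of a shortest $u$–$v$ path, the eccentricity of $v$ is $\mathrm{ecc}(v)=\max_{w\in V}\mathrm{dist}(v,w)$, the diameter is the maximum eccentricity, and the eccentric connectivity index is $\xi^c(G)=\sum_{v\in V}\deg(v)\,\mathrm{ecc}(v)$. $M_n$ denotes the graph obtained from the complete graph $K_n$ by removing a maximum matching (i.e. $\lfloor n/2\rfloor$ pairwise disjoint edges) and, if $n$ is odd, additionally removing one edge incident to the unique vertex that still has degree $n-1$; thus every vertex of $M_n$ has degree $n-2$, except possibly one of degree $n-3$. $H_1$ is the wheel on $5$ vertices: a cycle on $4$ vertices together with a fifth vertex adjacent to all four cycle vertices. -}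

module Defs where

open import Data.Nat using (ℕ; zero; suc; _+_; _*_; _∸_; _⊔_; _≡ᵇ_; _/_; _%_)
open import Data.Nat.Base using (_≤ᵇ_)
open import Data.Bool using (Bool; true; false; _∧_; _∨_; not; if_then_else_)
open import Data.Fin using (Fin; toℕ; _≟_; zero; suc)
open import Data.List using (List; map; foldr; allFin)
open import Data.Bool.ListAction using (any)
open import Data.Nat.ListAction using (sum)
open import Data.Bool.Properties using (∨-comm)
open import Relation.Nullary.Decidable using (⌊_⌋)
open import Relation.Binary.PropositionalEquality using (_≡_; refl; cong; cong₂)
open import Function.Bundles using (_↔_; Inverse)

record Graph (n : ℕ) : Set where
  field
    adj    : Fin n → Fin n → Bool
    sym    : ∀ u v → adj u v ≡ adj v u
    irrefl : ∀ v → adj v v ≡ false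
open Graph public

module _ {n : ℕ} (G : Graph n) where

  ball : ℕ → Fin n → Fin n → Bool
  ball zero    v w = ⌊ v ≟ w ⌋
  ball (suc k) v w = ball k v w ∨ any (λ u → ball k v u ∧ adj G u w) (allFin n)

  Connected : Set
  Connected = ∀ v w → Data.Product.∃ λ k → ball k v w ≡ true
    where import Data.Product

leastFrom : (ℕ → Bool) → ℕ → ℕ → ℕ
leastFrom p k zero = k
leastFrom p k (suc fuel) = if p k then k else leastFrom p (suc k) fuel

maxList : List ℕ → ℕ
maxList = foldr _⊔_ 0

module _ {n : ℕ} (G : Graph n) where

  -- shortest-path distance (for connected graphs every distance is < n,
  -- so the search over 0..n finds it)
  dist : Fin n → Fin n → ℕ
  dist v w = leastFrom (λ k → ball G k v w) 0 n

  ecc : Fin n → ℕ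
  ecc v = maxList (map (dist v) (allFin n))

  diameter : ℕ
  diameter = maxList (map ecc (allFin n))

  degree : Fin n → ℕ
  degree v = sum (map (λ w → if adj G v w then 1 else 0) (allFin n))

  ξᶜ : ℕ
  ξᶜ = sum (map (λ v → degree v * ecc v) (allFin n))

≡ᵇ-sym : ∀ x y → (x ≡ᵇ y) ≡ (y ≡ᵇ x)
≡ᵇ-sym zero zero = refl
≡ᵇ-sym zero (suc y) = refl
≡ᵇ-sym (suc x) zero = refl
≡ᵇ-sym (suc x) (suc y) = ≡ᵇ-sym x y

≡ᵇ-refl : ∀ x → (x ≡ᵇ x) ≡ true
≡ᵇ-refl zero = refl
≡ᵇ-refl (suc x) = ≡ᵇ-refl x

record _≃_ {n m : ℕ} (G : Graph n) (H : Graph m) : Set where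
  field
    bij      : Fin n ↔ Fin m
    preserve : ∀ u v → adj H (Inverse.to bij u) (Inverse.to bij v) ≡ adj G u v

-- M_n: K_n minus the matching {2i, 2i+1}; if n is odd the unmatched vertex n-1
-- additionally loses its edge to vertex 0.
M : (n : ℕ) → Graph n
M n = record { adj = a ; sym = s ; irrefl = i }
  where
    isOdd : Bool
    isOdd = n % 2 ≡ᵇ 1
    special : ℕ → ℕ → Bool
    special x y = (x ≡ᵇ 0) ∧ (y ≡ᵇ (n ∸ 1))
    a : Fin n → Fin n → Bool
    a u v = not (toℕ u / 2 ≡ᵇ toℕ v / 2)
          ∧ not (isOdd ∧ (special (toℕ u) (toℕ v) ∨ special (toℕ v) (toℕ u)))
    s : ∀ u v → a u v ≡ a v u
    s u v rewrite ≡ᵇ-sym (toℕ u / 2) (toℕ v / 2)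
                | ∨-comm (special (toℕ u) (toℕ v)) (special (toℕ v) (toℕ u)) = refl
    i : ∀ v → a v v ≡ false
    i v rewrite ≡ᵇ-refl (toℕ v / 2) = refl

-- H₁: the wheel on 5 vertices; hub 4, rim cycle 0-1-2-3-0
-- (so the only non-adjacent pairs are the rim diagonals {0,2} and {1,3}).
H₁ : Graph 5
H₁ = record { adj = a ; sym = s ; irrefl = i }
  where
    diag : ℕ → ℕ → Bool
    diag x y = ((x ≡ᵇ 0) ∧ (y ≡ᵇ 2)) ∨ ((x ≡ᵇ 1) ∧ (y ≡ᵇ 3))
    a : Fin 5 → Fin 5 → Bool
    a u v = not ⌊ u ≟ v ⌋ ∧ not (diag (toℕ u) (toℕ v) ∨ diag (toℕ v) (toℕ u))
    s : ∀ u v → a u v ≡ a v u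
    s zero zero = refl
    s zero (suc zero) = refl
    s zero (suc (suc zero)) = refl
    s zero (suc (suc (suc zero))) = refl
    s zero (suc (suc (suc (suc zero)))) = refl
    s (suc zero) zero = refl
    s (suc zero) (suc zero) = refl
    s (suc zero) (suc (suc zero)) = refl
    s (suc zero) (suc (suc (suc zero))) = refl
    s (suc zero) (suc (suc (suc (suc zero)))) = refl
    s (suc (suc zero)) zero = refl
    s (suc (suc zero)) (suc zero) = refl
    s (suc (suc zero)) (suc (suc zero)) = refl
    s (suc (suc zero)) (suc (suc (suc zero))) = refl
    s (suc (suc zero)) (suc (suc (suc (suc zero)))) = refl
    s (suc (suc (suc zero))) zero = refl
    s (suc (suc (suc zero))) (suc zero) = refl
    s (suc (suc (suc zero))) (suc (suc zero)) = refl
    s (suc (suc (suc zero))) (suc (suc (suc zero))) = refl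
    s (suc (suc (suc zero))) (suc (suc (suc (suc zero)))) = refl
    s (suc (suc (suc (suc zero)))) zero = refl
    s (suc (suc (suc (suc zero)))) (suc zero) = refl
    s (suc (suc (suc (suc zero)))) (suc (suc zero)) = refl
    s (suc (suc (suc (suc zero)))) (suc (suc (suc zero))) = refl
    s (suc (suc (suc (suc zero)))) (suc (suc (suc (suc zero)))) = refl
    i : ∀ v → a v v ≡ false
    i zero = refl
    i (suc zero) = refl
    i (suc (suc zero)) = refl
    i (suc (suc (suc zero))) = refl
    i (suc (suc (suc (suc zero)))) = refl

-- Let c(v) be the number of vertices not adjacent to v, v itself included. In a graph of
-- diameter 2, ecc(v) is 1 if c(v) = 1 and 2 otherwise, so deg(v)·ecc(v) = 2(n − 2) − r(v), where
-- r(v) = n − 3 if c(v) = 1 and r(v) = 2(c(v) − 2) otherwise; hence ξᶜ(G) = 2n(n − 2) − Σ r.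
-- Σ (c(v) − 1) counts every non-edge twice, so it is even. For odd n, either some c(v) = 1 and
-- r(v) = n − 3 ≥ 2, or every c(v) ≥ 2 and Σ r = 2 Σ (c(v) − 1) − 2n ≥ 2 by parity; thus
-- Σ r ≥ 2 (n mod 2). When equality holds, the complement of G is a perfect matching (n even),
-- a matching plus a path on three vertices (n odd), or, for n = 5, a matching of two edges
-- plus an isolated vertex, i.e. G is the wheel H₁. In each case a permutation conjugating the
-- complementary matching to the pairing {2i, 2i + 1} is an isomorphism onto M n (or H₁).

module Submission where

open import Defs renaming (sym to adj-sym)
open import Data.Nat using (ℕ; zero; suc; _+_; _*_; _∸_; _%_; _/_; _≡ᵇ_; _≤_; _<_; _<?_; z≤n; s≤s; s≤s⁻¹)
open import Data.Nat.Properties hiding (_≟_)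
open import Data.Nat.Properties using () renaming (_≟_ to _≟ℕ_)
open import Data.Nat.DivMod using (m*n%n≡0; m%n<n; m/n≡1+[m∸n]/n)
open import Data.Nat.Tactic.RingSolver using (solve-∀)
import Data.Nat.ListAction as List using (sum)
open import Data.Bool using (Bool; true; false; _∧_; _∨_; not; if_then_else_)
import Data.Bool.Properties as Bool using (_≟_)
open import Data.Bool.Properties using (∨-identityʳ; ∧-zeroʳ; ∨-zeroʳ)
open import Data.Bool.ListAction using (any; or)
import Data.List.Base as List using (map; tabulate; allFin)
import Data.List.Properties as List using (map-tabulate; tabulate-cong)
open import Data.Product using (_×_; _,_; Σ; ∃; proj₁; proj₂; map₂)
open import Data.Sum using (_⊎_; inj₁; inj₂; [_,_]′) renaming (map₂ to ⊎-map₂)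
open import Data.Empty using (⊥-elim)
open import Data.Fin using (Fin; zero; suc; toℕ; fromℕ; fromℕ<; _≟_)
open import Data.Fin.Properties using (toℕ-injective; toℕ-fromℕ<; toℕ<n; toℕ-fromℕ; any?; all?)
open import Data.Fin.Patterns using (1F; 2F)
import Data.Fin.Permutation as Perm using (id)
open import Data.Fin.Permutation using (Permutation′; _⟨$⟩ʳ_; _⟨$⟩ˡ_; inverseˡ; inverseʳ; _∘ₚ_; flip; transpose)
import Data.Fin.Permutation.Components as PC
open import Algebra.Properties.CommutativeMonoid.Sum +-0-commutativeMonoid
  using (sum; sum-cong-≗; ∑-distrib-+; sum-permute)
open import Function using (_∘_; case_of_)
open import Function.Bundles using (_⇔_; mk⇔; Equivalence; Inverse)
open import Relation.Binary.Definitions using (tri<; tri≈; tri>)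
open import Relation.Binary.PropositionalEquality
open import Relation.Nullary using (¬_; Dec; yes; no; does)
open import Relation.Nullary.Decidable using (⌊_⌋; toWitness; dec-true; dec-false; dec-yes; dec-no; isYes≗does; does-⇔)

sum-allFin : ∀ {n} (f : Fin n → ℕ) → List.sum (List.map f (List.allFin n)) ≡ sum f
sum-allFin f = trans (cong List.sum (List.map-tabulate (λ i → i) f)) (go f)
  where
  go : ∀ {n} (f : Fin n → ℕ) → List.sum (List.tabulate f) ≡ sum f
  go {zero} f = refl
  go {suc n} f = cong (f zero +_) (go (f ∘ suc))

sum-const : ∀ n k → sum {n} (λ _ → k) ≡ n * k
sum-const zero k = refl
sum-const (suc n) k = cong (k +_) (sum-const n k)

sum-zero : ∀ {n} (f : Fin n → ℕ) → (∀ i → f i ≡ 0) → sum f ≡ 0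
sum-zero {n} f f≡0 = trans (sum-cong-≗ f≡0) (trans (sum-const n 0) (*-zeroʳ n))

sum-*ˡ : ∀ {n} k (f : Fin n → ℕ) → sum (λ i → k * f i) ≡ k * sum f
sum-*ˡ {zero} k f = sym (*-zeroʳ k)
sum-*ˡ {suc n} k f = trans (cong (k * f zero +_) (sum-*ˡ k (f ∘ suc))) (sym (*-distribˡ-+ k (f zero) _))

≤-sum : ∀ {n} (f : Fin n → ℕ) i → f i ≤ sum f
≤-sum f zero = m≤m+n _ _
≤-sum f (suc i) = ≤-trans (≤-sum (f ∘ suc) i) (m≤n+m _ (f zero))

sum-mono-≤ : ∀ {n} {f g : Fin n → ℕ} → (∀ i → f i ≤ g i) → sum f ≤ sum g
sum-mono-≤ {zero} f≤g = z≤n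
sum-mono-≤ {suc n} f≤g = +-mono-≤ (f≤g zero) (sum-mono-≤ (f≤g ∘ suc))

sum≡0⇒≡0 : ∀ {n} (f : Fin n → ℕ) → sum f ≡ 0 → ∀ i → f i ≡ 0
sum≡0⇒≡0 f eq i = n≤0⇒n≡0 (subst (f i ≤_) eq (≤-sum f i))

sum-pos : ∀ {n} (f : Fin n → ℕ) → 0 < sum f → ∃ λ j → 0 < f j
sum-pos {suc n} f pos with f zero in eq
... | suc _ = zero , subst (0 <_) (sym eq) (s≤s z≤n)
... | zero with sum-pos (f ∘ suc) pos
...   | j , 0<fj = suc j , 0<fj

erase : ∀ {n} → Fin n → (Fin n → ℕ) → Fin n → ℕ
erase i f w = if does (w ≟ i) then 0 else f w

erase-≡ : ∀ {n} (i : Fin n) f → erase i f i ≡ 0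
erase-≡ i f rewrite dec-true (i ≟ i) refl = refl

erase-≢ : ∀ {n} {i j : Fin n} f → j ≢ i → erase i f j ≡ f j
erase-≢ {i = i} {j} f j≢i rewrite dec-false (j ≟ i) j≢i = refl

erase-pos⇒≢ : ∀ {n} {i j : Fin n} f → 0 < erase i f j → j ≢ i
erase-pos⇒≢ {i = i} f pos refl = <-irrefl refl (subst (0 <_) (erase-≡ i f) pos)

sum-erase : ∀ {n} (f : Fin n → ℕ) i → sum f ≡ f i + sum (erase i f)
sum-erase f zero = refl
sum-erase f (suc i) = trans (cong (f zero +_) (sum-erase (f ∘ suc) i)) (swap (f zero) (f (suc i)) _)
  where
  swap : ∀ a b c → a + (b + c) ≡ b + (a + c)
  swap = solve-∀

sum-pos-elsewhere : ∀ {n} (f : Fin n → ℕ) i → f i < sum f → ∃ λ j → j ≢ i × 0 < f j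
sum-pos-elsewhere f i fi<sum =
  map₂ (λ pos → erase-pos⇒≢ f pos , subst (0 <_) (erase-≢ f (erase-pos⇒≢ f pos)) pos) (sum-pos (erase i f) 0<rest)
  where
  open ≤-Reasoning
  0<rest : 0 < sum (erase i f)
  0<rest = +-cancelˡ-< (f i) 0 _ (begin-strict
    f i + 0                ≡⟨ +-identityʳ (f i) ⟩
    f i                    <⟨ fi<sum ⟩
    sum f                  ≡⟨ sum-erase f i ⟩
    f i + sum (erase i f)  ∎)

+-≤-sum : ∀ {n} (f : Fin n → ℕ) {i j} → j ≢ i → f i + f j ≤ sum f
+-≤-sum f {i} {j} j≢i = subst (f i + f j ≤_) (sym (sum-erase f i))
  (+-monoʳ-≤ (f i) (subst (_≤ sum (erase i f)) (erase-≢ f j≢i) (≤-sum (erase i f) j)))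

+-+-≤-sum : ∀ {n} (f : Fin n → ℕ) {i j k} → j ≢ i → k ≢ i → k ≢ j → f i + (f j + f k) ≤ sum f
+-+-≤-sum f {i} {j} {k} j≢i k≢i k≢j = subst (f i + (f j + f k) ≤_) (sym (sum-erase f i))
  (+-monoʳ-≤ (f i) (subst₂ (λ a b → a + b ≤ sum (erase i f)) (erase-≢ f j≢i) (erase-≢ f k≢i) (+-≤-sum (erase i f) k≢j)))

≡sum⇒≡0 : ∀ {n} (f : Fin n → ℕ) {v} → f v ≡ sum f → ∀ {w} → w ≢ v → f w ≡ 0
≡sum⇒≡0 f {v} fv≡sum {w} w≢v =
  n≤0⇒n≡0 (+-cancelˡ-≤ (f v) (f w) 0 (subst (f v + f w ≤_) (trans (sym fv≡sum) (sym (+-identityʳ (f v)))) (+-≤-sum f w≢v)))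

sum-two-points : ∀ {n} (f : Fin n → ℕ) {a b} → b ≢ a → f a ≡ 1 → f b ≡ 1 → (∀ w → w ≢ a → w ≢ b → f w ≡ 0) → sum f ≡ 2
sum-two-points f {a} {b} b≢a fa fb rest = begin
  sum f                                           ≡⟨ sum-erase f a ⟩
  f a + sum (erase a f)                           ≡⟨ cong (f a +_) (sum-erase (erase a f) b) ⟩
  f a + (erase a f b + sum (erase b (erase a f))) ≡⟨ cong₂ (λ x y → x + (y + sum (erase b (erase a f)))) fa (trans (erase-≢ f b≢a) fb) ⟩
  1 + (1 + sum (erase b (erase a f)))             ≡⟨ cong (λ x → 1 + (1 + x)) (sum-zero _ none) ⟩
  2                                               ∎
  where
  open ≡-Reasoning
  none : ∀ w → erase b (erase a f) w ≡ 0
  none w with w ≟ b | w ≟ a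
  ... | yes _ | _ = refl
  ... | no _ | yes _ = refl
  ... | no w≢b | no w≢a = rest w w≢a w≢b

sum-three-points : ∀ {n} (f : Fin n → ℕ) {a b c} → b ≢ a → c ≢ a → c ≢ b → f a ≡ 1 → f b ≡ 1 → f c ≡ 1 →
                   (∀ w → w ≢ a → w ≢ b → w ≢ c → f w ≡ 0) → sum f ≡ 3
sum-three-points f {a} {b} {c} b≢a c≢a c≢b fa fb fc rest =
  trans (sum-erase f a) (cong₂ _+_ fa (sum-two-points (erase a f) c≢b (trans (erase-≢ f b≢a) fb) (trans (erase-≢ f c≢a) fc) rest′))
  where
  rest′ : ∀ w → w ≢ b → w ≢ c → erase a f w ≡ 0
  rest′ w w≢b w≢c with w ≟ a
  ... | yes _ = refl
  ... | no w≢a = rest w w≢a w≢b w≢c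

maxList-map-allFin : ∀ {n} (f : Fin n → ℕ) → maxList (List.map f (List.allFin n)) ≡ maxList (List.tabulate f)
maxList-map-allFin f = cong maxList (List.map-tabulate (λ i → i) f)

≤-maxList-tabulate : ∀ {n} (f : Fin n → ℕ) i → f i ≤ maxList (List.tabulate f)
≤-maxList-tabulate f zero = m≤m⊔n _ _
≤-maxList-tabulate f (suc i) = ≤-trans (≤-maxList-tabulate (f ∘ suc) i) (m≤n⊔m (f zero) _)

maxList-tabulate-≤ : ∀ {n} (f : Fin n → ℕ) {b} → (∀ i → f i ≤ b) → maxList (List.tabulate f) ≤ b
maxList-tabulate-≤ {zero} f f≤b = z≤n
maxList-tabulate-≤ {suc n} f f≤b = ⊔-lub (f≤b zero) (maxList-tabulate-≤ (f ∘ suc) (f≤b ∘ suc))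

≤-leastFrom : ∀ p k fuel → k ≤ leastFrom p k fuel
≤-leastFrom p k zero = ≤-refl
≤-leastFrom p k (suc fuel) with p k
... | true = ≤-refl
... | false = ≤-trans (n≤1+n k) (≤-leastFrom p (suc k) fuel)

isYes-true : ∀ {p} {P : Set p} (d : Dec P) → P → ⌊ d ⌋ ≡ true
isYes-true d p = trans (isYes≗does d) (dec-true d p)

isYes-false : ∀ {p} {P : Set p} (d : Dec P) → ¬ P → ⌊ d ⌋ ≡ false
isYes-false d ¬p = trans (isYes≗does d) (dec-false d ¬p)

does≡true : ∀ {p} {P : Set p} (d : Dec P) → does d ≡ true → P
does≡true (yes p) _ = p

∧≡true : ∀ {x y} → x ∧ y ≡ true → x ≡ true × y ≡ true
∧≡true {true} {true} _ = refl , refl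

or-tabulate-diagonal : ∀ {n} (v : Fin n) (g : Fin n → Bool) → or (List.tabulate (λ u → ⌊ v ≟ u ⌋ ∧ g u)) ≡ g v
or-tabulate-diagonal {suc n} zero g = trans (cong (g zero ∨_) (none n)) (∨-identityʳ (g zero))
  where
  none : ∀ n → or (List.tabulate {n = n} (λ _ → false)) ≡ false
  none zero = refl
  none (suc n) = none n
or-tabulate-diagonal {suc n} (suc v) g = trans (cong or (List.tabulate-cong (λ u → cong (_∧ g (suc u)) (suc-isYes u))))
                                              (or-tabulate-diagonal v (g ∘ suc))
  where
  suc-isYes : ∀ u → ⌊ suc v ≟ suc u ⌋ ≡ ⌊ v ≟ u ⌋
  suc-isYes u with v ≟ u
  ... | yes _ = refl
  ... | no _ = refl

any-allFin-diagonal : ∀ {n} (v : Fin n) (g : Fin n → Bool) → any (λ u → ⌊ v ≟ u ⌋ ∧ g u) (List.allFin n) ≡ g v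
any-allFin-diagonal v g = trans (cong or (List.map-tabulate (λ i → i) (λ u → ⌊ v ≟ u ⌋ ∧ g u))) (or-tabulate-diagonal v g)

module _ {n : ℕ} (G : Graph n) where

  nonadj : Fin n → Fin n → ℕ
  nonadj v w = if adj G v w then 0 else 1

  -- v itself is counted, since adj G v v ≡ false
  codegree : Fin n → ℕ
  codegree v = sum (nonadj v)

  nonadj-self : ∀ v → nonadj v v ≡ 1
  nonadj-self v rewrite irrefl G v = refl

  nonadj-false : ∀ {v w} → adj G v w ≡ false → nonadj v w ≡ 1
  nonadj-false eq rewrite eq = refl

  nonadj-pos : ∀ {v w} → 0 < nonadj v w → adj G v w ≡ false
  nonadj-pos {v} {w} pos with adj G v w
  ... | true = ⊥-elim (<-irrefl refl pos)
  ... | false = refl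

  nonadj-sym : ∀ {u v} → adj G u v ≡ false → adj G v u ≡ false
  nonadj-sym {u} {v} uv = trans (adj-sym G v u) uv

  degree+codegree : ∀ v → degree G v + codegree v ≡ n
  degree+codegree v = begin
    degree G v + codegree v                                ≡⟨ cong (_+ codegree v) (sum-allFin (λ w → if adj G v w then 1 else 0)) ⟩
    sum (λ w → if adj G v w then 1 else 0) + codegree v    ≡⟨ ∑-distrib-+ (λ w → if adj G v w then 1 else 0) (nonadj v) ⟨
    sum (λ w → (if adj G v w then 1 else 0) + nonadj v w)  ≡⟨ sum-cong-≗ one ⟩
    sum {n} (λ _ → 1)                                      ≡⟨ trans (sum-const n 1) (*-identityʳ n) ⟩
    n                                                      ∎
    where
    open ≡-Reasoning
    one : ∀ w → (if adj G v w then 1 else 0) + nonadj v w ≡ 1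
    one w with adj G v w
    ... | true = refl
    ... | false = refl

  1≤codegree : ∀ v → 1 ≤ codegree v
  1≤codegree v = subst (_≤ codegree v) (nonadj-self v) (≤-sum (nonadj v) v)

  codegree≡1⇒adj : ∀ {v} → codegree v ≡ 1 → ∀ {w} → w ≢ v → adj G v w ≡ true
  codegree≡1⇒adj {v} c≡1 {w} w≢v with adj G v w in eq
  ... | true = refl
  ... | false = ⊥-elim (<-irrefl refl (begin-strict
    2                                ≡⟨ cong₂ _+_ (nonadj-self v) (nonadj-false eq) ⟨
    nonadj v v + nonadj v w          ≤⟨ +-≤-sum (nonadj v) w≢v ⟩
    codegree v                       ≡⟨ c≡1 ⟩
    1                                <⟨ s≤s (s≤s z≤n) ⟩
    2                                ∎))
    where open ≤-Reasoning

  nonneighbour : ∀ {v} → 2 ≤ codegree v → ∃ λ w → w ≢ v × adj G v w ≡ false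
  nonneighbour {v} 2≤c with sum-pos-elsewhere (nonadj v) v (subst (_< codegree v) (sym (nonadj-self v)) 2≤c)
  ... | w , w≢v , pos = w , w≢v , nonadj-pos pos

  ball-1 : ∀ {v w} → v ≢ w → ball G 1 v w ≡ adj G v w
  ball-1 {v} {w} v≢w = trans (cong (_∨ any (λ u → ⌊ v ≟ u ⌋ ∧ adj G u w) (List.allFin n)) (isYes-false (v ≟ w) v≢w))
                             (any-allFin-diagonal v (λ u → adj G u w))

another : ∀ {m} → Fin (suc (suc m)) → Fin (suc (suc m))
another zero = suc zero
another (suc _) = zero

another≢ : ∀ {m} (v : Fin (suc (suc m))) → another v ≢ v
another≢ zero ()
another≢ (suc _) ()

module _ {m : ℕ} (G : Graph (suc (suc m))) where

  private
    search : Fin (suc (suc m)) → Fin (suc (suc m)) → ℕ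
    search v w = leastFrom (λ k → ball G k v w) 2 m

    dist-≢ : ∀ {v w} → v ≢ w → dist G v w ≡ (if ball G 1 v w then 1 else search v w)
    dist-≢ {v} {w} v≢w = cong (λ b → if b then 0 else (if ball G 1 v w then 1 else search v w)) (isYes-false (v ≟ w) v≢w)

  dist-refl : ∀ v → dist G v v ≡ 0
  dist-refl v = cong (λ b → if b then 0 else (if ball G 1 v v then 1 else search v v)) (isYes-true (v ≟ v) refl)

  dist-adj : ∀ {v w} → v ≢ w → adj G v w ≡ true → dist G v w ≡ 1
  dist-adj {v} {w} v≢w vw = trans (dist-≢ v≢w) (cong (λ b → if b then 1 else search v w) (trans (ball-1 G v≢w) vw))

  2≤dist : ∀ {v w} → v ≢ w → adj G v w ≡ false → 2 ≤ dist G v w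
  2≤dist {v} {w} v≢w vw = subst (2 ≤_)
    (sym (trans (dist-≢ v≢w) (cong (λ b → if b then 1 else search v w) (trans (ball-1 G v≢w) vw))))
    (≤-leastFrom _ 2 m)

  dist≤ecc : ∀ v w → dist G v w ≤ ecc G v
  dist≤ecc v w = subst (dist G v w ≤_) (sym (maxList-map-allFin (dist G v))) (≤-maxList-tabulate (dist G v) w)

  ecc≤diameter : ∀ v → ecc G v ≤ diameter G
  ecc≤diameter v = subst (ecc G v ≤_) (sym (maxList-map-allFin (ecc G))) (≤-maxList-tabulate (ecc G) v)

  ecc-dominating : ∀ {v} → (∀ {w} → w ≢ v → adj G v w ≡ true) → ecc G v ≡ 1
  ecc-dominating {v} dom = ≤-antisym
    (subst (_≤ 1) (sym (maxList-map-allFin (dist G v))) (maxList-tabulate-≤ (dist G v) dist≤1))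
    (subst (_≤ ecc G v) (dist-adj (another≢ v ∘ sym) (dom (another≢ v))) (dist≤ecc v (another v)))
    where
    dist≤1 : ∀ w → dist G v w ≤ 1
    dist≤1 w = by-cases (v ≟ w)
      where
      by-cases : Dec (v ≡ w) → dist G v w ≤ 1
      by-cases (yes refl) = subst (_≤ 1) (sym (dist-refl v)) z≤n
      by-cases (no v≢w) = ≤-reflexive (dist-adj v≢w (dom (v≢w ∘ sym)))

  ecc-diameter-2 : diameter G ≡ 2 → ∀ {v w} → w ≢ v → adj G v w ≡ false → ecc G v ≡ 2
  ecc-diameter-2 diam {v} {w} w≢v vw = ≤-antisym (subst (ecc G v ≤_) diam (ecc≤diameter v))
    (≤-trans (2≤dist (w≢v ∘ sym) vw) (dist≤ecc v w))

-- The eccentric connectivity index through the defect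

-- 2(n − 2) − degree · ecc for a vertex with x non-neighbours besides itself, in a graph of diameter 2
defectOf : ℕ → ℕ → ℕ
defectOf n zero = n ∸ 3
defectOf n (suc x) = 2 * x

defect : ∀ {n} → Graph n → Fin n → ℕ
defect {n} G v = defectOf n (codegree G v ∸ 1)

module _ {m : ℕ} (G : Graph (suc (suc m))) (diam : diameter G ≡ 2) (1≤m : 1 ≤ m) where

  degree*ecc+defect : ∀ v → degree G v * ecc G v + defect G v ≡ 2 * m
  degree*ecc+defect v with codegree G v in c≡ | degree+codegree G v
  ... | zero | _ = ⊥-elim (<-irrefl refl (subst (1 ≤_) c≡ (1≤codegree G v)))
  ... | suc zero | d+1≡n rewrite ecc-dominating G (codegree≡1⇒adj G c≡) =
    trans (cong (λ d → d * 1 + (m ∸ 1)) (+-cancelʳ-≡ 1 _ _ (trans d+1≡n (+-comm 1 (suc m))))) (arith m 1≤m)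
    where
    arith : ∀ m → 1 ≤ m → suc m * 1 + (m ∸ 1) ≡ 2 * m
    arith (suc m) _ = ring m
      where
      ring : ∀ m → suc (suc m) * 1 + m ≡ 2 * suc m
      ring = solve-∀
  ... | suc (suc y) | d+c≡n with nonneighbour G (subst (2 ≤_) (sym c≡) (s≤s (s≤s z≤n)))
  ...   | w , w≢v , vw rewrite ecc-diameter-2 G diam w≢v vw =
    trans (arith (degree G v) y) (cong (2 *_) (+-cancelʳ-≡ 2 _ _ (trans (swap (degree G v) y) (trans d+c≡n (+-comm 2 m)))))
    where
    arith : ∀ d y → d * 2 + 2 * y ≡ 2 * (d + y)
    arith = solve-∀
    swap : ∀ d y → d + y + 2 ≡ d + suc (suc y)
    swap = solve-∀

  ξᶜ+∑defect : ξᶜ G + sum (defect G) ≡ suc (suc m) * (2 * m)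
  ξᶜ+∑defect = begin
    ξᶜ G + sum (defect G)                                         ≡⟨ cong (_+ sum (defect G)) (sum-allFin (λ v → degree G v * ecc G v)) ⟩
    sum (λ v → degree G v * ecc G v) + sum (defect G)             ≡⟨ ∑-distrib-+ (λ v → degree G v * ecc G v) (defect G) ⟨
    sum (λ v → degree G v * ecc G v + defect G v)                 ≡⟨ sum-cong-≗ degree*ecc+defect ⟩
    sum {suc (suc m)} (λ _ → 2 * m)                               ≡⟨ sum-const (suc (suc m)) (2 * m) ⟩
    suc (suc m) * (2 * m)                                         ∎
    where open ≡-Reasoning

-- The lower bound on the total defect

sum-symmetric-even : ∀ {n} (f : Fin n → Fin n → ℕ) → (∀ i j → f i j ≡ f j i) → (∀ i → f i i ≡ 0) →
                     ∃ λ k → sum (λ i → sum (f i)) ≡ k + k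
sum-symmetric-even {zero} f f-sym f-diag = 0 , refl
sum-symmetric-even {suc n} f f-sym f-diag with sum-symmetric-even (λ i j → f (suc i) (suc j)) (λ i j → f-sym (suc i) (suc j)) (f-diag ∘ suc)
... | k , ∑rest≡k+k = row + k , (begin
    sum (f zero) + sum (λ i → f (suc i) zero + sum (λ j → f (suc i) (suc j)))
      ≡⟨ cong₂ _+_ (cong (_+ row) (f-diag zero)) (∑-distrib-+ (λ i → f (suc i) zero) (λ i → sum (λ j → f (suc i) (suc j)))) ⟩
    row + (sum (λ i → f (suc i) zero) + sum (λ i → sum (λ j → f (suc i) (suc j))))
      ≡⟨ cong₂ (λ a b → row + (a + b)) (sum-cong-≗ (λ i → f-sym (suc i) zero)) ∑rest≡k+k ⟩
    row + (row + (k + k))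
      ≡⟨ arith row k ⟩
    row + k + (row + k) ∎)
  where
  open ≡-Reasoning
  row : ℕ
  row = sum (f zero ∘ suc)
  arith : ∀ a k → a + (a + (k + k)) ≡ a + k + (a + k)
  arith = solve-∀

k+k%2≡0 : ∀ k → (k + k) % 2 ≡ 0
k+k%2≡0 k = trans (cong (_% 2) (k+k≡k*2 k)) (m*n%n≡0 k 2)
  where
  k+k≡k*2 : ∀ k → k + k ≡ k * 2
  k+k≡k*2 = solve-∀

%2≡0⊎%2≡1 : ∀ n → n % 2 ≡ 0 ⊎ n % 2 ≡ 1
%2≡0⊎%2≡1 n with n % 2 | m%n<n n 2
... | 0 | _ = inj₁ refl
... | 1 | _ = inj₂ refl
... | suc (suc _) | s≤s (s≤s ())

odd⇒3≤m : ∀ m → 2 ≤ m → suc (suc m) % 2 ≡ 1 → 3 ≤ m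
odd⇒3≤m (suc zero) (s≤s ()) _
odd⇒3≤m (suc (suc zero)) _ ()
odd⇒3≤m (suc (suc (suc m))) _ _ = s≤s (s≤s (s≤s z≤n))

module _ {n : ℕ} (G : Graph n) where

  ∑codegree∸1-even : ∃ λ k → sum (λ v → codegree G v ∸ 1) ≡ k + k
  ∑codegree∸1-even = map₂ (trans (sum-cong-≗ row)) (sum-symmetric-even (λ v → erase v (nonadj G v)) erase-sym (λ v → erase-≡ v (nonadj G v)))
    where
    erase-sym : ∀ v w → erase v (nonadj G v) w ≡ erase w (nonadj G w) v
    erase-sym v w = cong₂ (λ b c → if b then 0 else (if c then 0 else 1))
      (does-⇔ (mk⇔ sym sym) (w ≟ v) (v ≟ w)) (adj-sym G v w)
    row : ∀ v → codegree G v ∸ 1 ≡ sum (erase v (nonadj G v))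
    row v = cong (_∸ 1) (trans (sum-erase (nonadj G v) v) (cong (_+ sum (erase v (nonadj G v))) (nonadj-self G v)))

module _ {m : ℕ} (G : Graph (suc (suc m))) (2≤m : 2 ≤ m) where

  private
    n : ℕ
    n = suc (suc m)
    x : Fin n → ℕ
    x v = codegree G v ∸ 1

  ∑defect+2n : (∀ v → x v ≢ 0) → sum (defect G) + n * 2 ≡ 2 * sum x
  ∑defect+2n x≢0 = begin
    sum (defect G) + n * 2                   ≡⟨ cong (sum (defect G) +_) (sum-const n 2) ⟨
    sum (defect G) + sum {n} (λ _ → 2)       ≡⟨ ∑-distrib-+ (defect G) (λ _ → 2) ⟨
    sum (λ v → defect G v + 2)               ≡⟨ sum-cong-≗ pointwise ⟩
    sum (λ v → 2 * x v)                      ≡⟨ sum-*ˡ 2 x ⟩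
    2 * sum x                                ∎
    where
    open ≡-Reasoning
    pointwise : ∀ v → defect G v + 2 ≡ 2 * x v
    pointwise v with x v | x≢0 v
    ... | zero | x≢0 = ⊥-elim (x≢0 refl)
    ... | suc y | _ = arith y
      where
      arith : ∀ y → 2 * y + 2 ≡ 2 * suc y
      arith = solve-∀

  n<∑codegree∸1 : n % 2 ≡ 1 → (∀ v → x v ≢ 0) → n < sum x
  n<∑codegree∸1 odd x≢0 with ∑codegree∸1-even G
  ... | k , ∑x≡k+k = ≤∧≢⇒< n≤∑x λ n≡∑x → 0≢1+n (trans (sym (k+k%2≡0 k)) (trans (cong (_% 2) (trans (sym ∑x≡k+k) (sym n≡∑x))) odd))
    where
    1≤x : ∀ v → 1 ≤ x v
    1≤x v with x v | x≢0 v
    ... | zero | x≢0 = ⊥-elim (x≢0 refl)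
    ... | suc _ | _ = s≤s z≤n
    n≤∑x : n ≤ sum x
    n≤∑x = subst (_≤ sum x) (trans (sum-const n 1) (*-identityʳ n)) (sum-mono-≤ 1≤x)

  ∑defect-lower : 2 * (n % 2) ≤ sum (defect G)
  ∑defect-lower with %2≡0⊎%2≡1 n
  ... | inj₁ even rewrite even = z≤n
  ... | inj₂ odd rewrite odd with any? (λ v → x v ≟ℕ 0)
  ...   | yes (v , x≡0) = ≤-trans (subst (2 ≤_) (sym (cong (defectOf n) x≡0)) (∸-monoˡ-≤ 1 (odd⇒3≤m m 2≤m odd))) (≤-sum (defect G) v)
  ...   | no ∄x≡0 = +-cancelʳ-≤ (n * 2) 2 (sum (defect G)) (begin
    2 + n * 2                ≡⟨ arith n ⟨
    2 * suc n                ≤⟨ *-monoʳ-≤ 2 (n<∑codegree∸1 odd x≢0) ⟩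
    2 * sum x                ≡⟨ ∑defect+2n x≢0 ⟨
    sum (defect G) + n * 2   ∎)
    where
    open ≤-Reasoning
    x≢0 : ∀ v → x v ≢ 0
    x≢0 v x≡0 = ∄x≡0 (v , x≡0)
    arith : ∀ n → 2 * suc n ≡ 2 + n * 2
    arith = solve-∀

-- The pairing {2i, 2i + 1} and the adjacency of M n

mate : ℕ → ℕ
mate zero = 1
mate (suc zero) = 0
mate (suc (suc k)) = suc (suc (mate k))

mate-involutive : ∀ k → mate (mate k) ≡ k
mate-involutive zero = refl
mate-involutive (suc zero) = refl
mate-involutive (suc (suc k)) = cong (λ k → suc (suc k)) (mate-involutive k)

mate-≢ : ∀ k → mate k ≢ k
mate-≢ (suc (suc k)) eq = mate-≢ k (suc-injective (suc-injective eq))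

double : ℕ → ℕ
double zero = zero
double (suc i) = suc (suc (double i))

mate-double : ∀ i → mate (double i) ≡ suc (double i)
mate-double zero = refl
mate-double (suc i) = cong (λ k → suc (suc k)) (mate-double i)

mate-< : ∀ i {k} → k < double i → mate k < double i
mate-< (suc i) {zero} _ = s≤s (s≤s z≤n)
mate-< (suc i) {suc zero} _ = s≤s z≤n
mate-< (suc i) {suc (suc k)} (s≤s (s≤s k<)) = s≤s (s≤s (mate-< i k<))

double⊎suc-double : ∀ n → ∃ λ i → n ≡ double i ⊎ n ≡ suc (double i)
double⊎suc-double zero = 0 , inj₁ refl
double⊎suc-double (suc zero) = 0 , inj₂ refl
double⊎suc-double (suc (suc n)) with double⊎suc-double n
... | i , inj₁ eq = suc i , inj₁ (cong (λ k → suc (suc k)) eq)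
... | i , inj₂ eq = suc i , inj₂ (cong (λ k → suc (suc k)) eq)

double%2 : ∀ i → double i % 2 ≡ 0
double%2 zero = refl
double%2 (suc i) = double%2 i

suc-double%2 : ∀ i → suc (double i) % 2 ≡ 1
suc-double%2 zero = refl
suc-double%2 (suc i) = suc-double%2 i

+2/2 : ∀ a → suc (suc a) / 2 ≡ suc (a / 2)
+2/2 a = m/n≡1+[m∸n]/n {suc (suc a)} {2} (s≤s (s≤s z≤n))

/2≡ᵇ/2 : ∀ a b → (a / 2 ≡ᵇ b / 2) ≡ ((a ≡ᵇ b) ∨ (b ≡ᵇ mate a))
/2≡ᵇ/2 zero zero = refl
/2≡ᵇ/2 zero (suc zero) = refl
/2≡ᵇ/2 zero (suc (suc b)) rewrite +2/2 b = refl
/2≡ᵇ/2 (suc zero) zero = refl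
/2≡ᵇ/2 (suc zero) (suc zero) = refl
/2≡ᵇ/2 (suc zero) (suc (suc b)) rewrite +2/2 b = refl
/2≡ᵇ/2 (suc (suc a)) zero rewrite +2/2 a = refl
/2≡ᵇ/2 (suc (suc a)) (suc zero) rewrite +2/2 a = refl
/2≡ᵇ/2 (suc (suc a)) (suc (suc b)) rewrite +2/2 a | +2/2 b = /2≡ᵇ/2 a b

toℕ≡ᵇtoℕ : ∀ {n} (a b : Fin n) → (toℕ a ≡ᵇ toℕ b) ≡ does (a ≟ b)
toℕ≡ᵇtoℕ zero zero = refl
toℕ≡ᵇtoℕ zero (suc b) = refl
toℕ≡ᵇtoℕ (suc a) zero = refl
toℕ≡ᵇtoℕ (suc a) (suc b) = toℕ≡ᵇtoℕ a b

-- for odd n the last vertex has no mate and is fixed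
mateFin : ∀ {n} → Fin n → Fin n
mateFin {n} a with mate (toℕ a) <? n
... | yes lt = fromℕ< lt
... | no _ = a

toℕ-mateFin : ∀ {n} (a : Fin n) → mate (toℕ a) < n → toℕ (mateFin a) ≡ mate (toℕ a)
toℕ-mateFin {n} a lt with mate (toℕ a) <? n
... | yes lt′ = toℕ-fromℕ< lt′
... | no ≮ = ⊥-elim (≮ lt)

mateFin-fixed : ∀ {n} (a : Fin n) → ¬ mate (toℕ a) < n → mateFin a ≡ a
mateFin-fixed {n} a ≮ with mate (toℕ a) <? n
... | yes lt = ⊥-elim (≮ lt)
... | no _ = refl

mateFin-involutive : ∀ {n} (a : Fin n) → mateFin (mateFin a) ≡ a
mateFin-involutive {n} a with mate (toℕ a) <? n
... | no ≮ = mateFin-fixed a ≮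
... | yes lt = toℕ-injective (trans (toℕ-mateFin (fromℕ< lt) lt′) mate-toℕ)
  where
  mate-toℕ : mate (toℕ (fromℕ< lt)) ≡ toℕ a
  mate-toℕ = trans (cong mate (toℕ-fromℕ< lt)) (mate-involutive (toℕ a))
  lt′ : mate (toℕ (fromℕ< lt)) < n
  lt′ = subst (_< n) (sym mate-toℕ) (toℕ<n a)

mateFin-< : ∀ {n} i (a : Fin n) → toℕ a < double i → double i ≤ n → toℕ (mateFin a) < double i
mateFin-< i a lt le = subst (_< double i) (sym (toℕ-mateFin a (<-≤-trans (mate-< i lt) le))) (mate-< i lt)

mateFin-double : ∀ {n} i (a : Fin n) → toℕ a ≡ double i → suc (double i) < n → toℕ (mateFin a) ≡ suc (double i)
mateFin-double {n} i a a≡ lt = trans (toℕ-mateFin a (subst (_< n) (sym mate-a) lt)) mate-a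
  where
  mate-a : mate (toℕ a) ≡ suc (double i)
  mate-a = trans (cong mate a≡) (mate-double i)

mateFin-suc-double : ∀ {n} i (a : Fin n) → toℕ a ≡ double i → n ≡ suc (double i) → mateFin a ≡ a
mateFin-suc-double {n} i a a≡ n≡ = mateFin-fixed a λ lt → <-irrefl refl (subst (_< n) (trans (trans (cong mate a≡) (mate-double i)) (sym n≡)) lt)

mateFin-fixed⇒≮ : ∀ {n} (a : Fin n) → mateFin a ≡ a → ¬ mate (toℕ a) < n
mateFin-fixed⇒≮ a fixed lt = mate-≢ (toℕ a) (trans (sym (toℕ-mateFin a lt)) (cong toℕ fixed))

mateFin-fixed⇒last : ∀ {k} (a : Fin (suc k)) → mateFin a ≡ a → a ≡ fromℕ k × suc k % 2 ≡ 1
mateFin-fixed⇒last {k} a fixed with double⊎suc-double (suc k)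
... | i , inj₁ n≡ = ⊥-elim (mateFin-fixed⇒≮ a fixed (subst (mate (toℕ a) <_) (sym n≡) (mate-< i (subst (toℕ a <_) n≡ (toℕ<n a)))))
... | i , inj₂ n≡ with toℕ a <? double i
...   | yes lt = ⊥-elim (mateFin-fixed⇒≮ a fixed (<-trans (mate-< i lt) (subst (double i <_) (sym n≡) (n<1+n _))))
...   | no ≮ = toℕ-injective (trans a≡ (trans (suc-injective (sym n≡)) (sym (toℕ-fromℕ k)))) , trans (cong (_% 2) n≡) (suc-double%2 i)
  where
  a≡ : toℕ a ≡ double i
  a≡ = ≤-antisym (s≤s⁻¹ (subst (toℕ a <_) n≡ (toℕ<n a))) (≮⇒≥ ≮)

mateFin-last : ∀ {k} → suc k % 2 ≡ 1 → mateFin (fromℕ k) ≡ fromℕ k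
mateFin-last {k} odd with double⊎suc-double (suc k)
... | i , inj₁ n≡ = ⊥-elim (0≢1+n (trans (sym (double%2 i)) (trans (cong (_% 2) (sym n≡)) odd)))
... | i , inj₂ n≡ = mateFin-suc-double i (fromℕ k) (trans (toℕ-fromℕ k) (suc-injective n≡)) n≡

mateFin-no-fixed : ∀ {n} → n % 2 ≡ 0 → (a : Fin n) → mateFin a ≢ a
mateFin-no-fixed {suc k} even a fixed = 0≢1+n (trans (sym even) (proj₂ (mateFin-fixed⇒last a fixed)))

coMatchingAdj : ∀ {n} → (Fin n → Fin n) → (Fin n → Fin n → Bool) → Fin n → Fin n → Bool
coMatchingAdj p E u v = not ((does (u ≟ v) ∨ does (v ≟ p u)) ∨ E u v)

coMatching-≃ : ∀ {n} {G T : Graph n} {p q : Fin n → Fin n} {E F : Fin n → Fin n → Bool} →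
  (∀ u v → adj G u v ≡ coMatchingAdj p E u v) → (∀ a b → adj T a b ≡ coMatchingAdj q F a b) →
  (ρ : Permutation′ n) → (∀ k → p (ρ ⟨$⟩ʳ k) ≡ ρ ⟨$⟩ʳ q k) → (∀ u v → F (ρ ⟨$⟩ˡ u) (ρ ⟨$⟩ˡ v) ≡ E u v) →
  G ≃ T
coMatching-≃ {n} {G} {T} {p} {q} {E} {F} adj-G adj-T ρ conj F≡E = record { bij = flip ρ ; preserve = preserve }
  where
  σ : Fin n → Fin n
  σ = ρ ⟨$⟩ˡ_
  ρσ : ∀ u → ρ ⟨$⟩ʳ σ u ≡ u
  ρσ u = inverseʳ ρ
  σ-injective : ∀ {u v} → σ u ≡ σ v → u ≡ v
  σ-injective {u} {v} eq = trans (sym (ρσ u)) (trans (cong (ρ ⟨$⟩ʳ_) eq) (ρσ v))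
  ρqσ : ∀ u → ρ ⟨$⟩ʳ q (σ u) ≡ p u
  ρqσ u = trans (sym (conj (σ u))) (cong p (ρσ u))
  mate⇔ : ∀ u v → (σ v ≡ q (σ u)) ⇔ (v ≡ p u)
  mate⇔ u v = mk⇔ (λ eq → trans (sym (ρσ v)) (trans (cong (ρ ⟨$⟩ʳ_) eq) (ρqσ u)))
                  (λ eq → trans (cong σ (trans eq (sym (ρqσ u)))) (inverseˡ ρ))
  preserve : ∀ u v → adj T (σ u) (σ v) ≡ adj G u v
  preserve u v = begin
    adj T (σ u) (σ v)                ≡⟨ adj-T (σ u) (σ v) ⟩
    coMatchingAdj q F (σ u) (σ v)    ≡⟨ cong not (cong₂ _∨_ (cong₂ _∨_ (does-⇔ (mk⇔ σ-injective (cong σ)) (σ u ≟ σ v) (u ≟ v))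
                                                                         (does-⇔ (mate⇔ u v) (σ v ≟ q (σ u)) (v ≟ p u)))
                                                            (F≡E u v)) ⟩
    coMatchingAdj p E u v            ≡⟨ adj-G u v ⟨
    adj G u v                        ∎
    where open ≡-Reasoning

not-∨ : ∀ x y → not (x ∨ y) ≡ not x ∧ not y
not-∨ true y = refl
not-∨ false y = refl

oddCorner : ∀ {k} → Fin (suc k) → Fin (suc k) → Bool
oddCorner {k} a b = (suc k % 2 ≡ᵇ 1) ∧ ((does (a ≟ zero) ∧ does (b ≟ fromℕ k)) ∨ (does (b ≟ zero) ∧ does (a ≟ fromℕ k)))

≡ᵇ-mate : ∀ {n} (a b : Fin n) → a ≢ b → (toℕ b ≡ᵇ mate (toℕ a)) ≡ does (b ≟ mateFin a)
≡ᵇ-mate {n} a b a≢b with mate (toℕ a) <? n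
... | yes lt = trans (cong (toℕ b ≡ᵇ_) (sym (toℕ-fromℕ< lt))) (toℕ≡ᵇtoℕ b (fromℕ< lt))
... | no ≮ = trans (dec-false (toℕ b ≟ℕ mate (toℕ a)) λ eq → ≮ (subst (_< n) eq (toℕ<n b))) (sym (dec-false (b ≟ a) (a≢b ∘ sym)))

/2≡ᵇ/2-Fin : ∀ {n} (a b : Fin n) → (toℕ a / 2 ≡ᵇ toℕ b / 2) ≡ (does (a ≟ b) ∨ does (b ≟ mateFin a))
/2≡ᵇ/2-Fin a b = by-cases (a ≟ b)
  where
  by-cases : Dec (a ≡ b) → (toℕ a / 2 ≡ᵇ toℕ b / 2) ≡ (does (a ≟ b) ∨ does (b ≟ mateFin a))
  by-cases (yes refl) rewrite /2≡ᵇ/2 (toℕ a) (toℕ a) | toℕ≡ᵇtoℕ a a | dec-true (a ≟ a) refl = refl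
  by-cases (no a≢b) = trans (/2≡ᵇ/2 (toℕ a) (toℕ b)) (cong₂ _∨_ (toℕ≡ᵇtoℕ a b) (≡ᵇ-mate a b a≢b))

adj-M : ∀ {k} (a b : Fin (suc k)) → adj (M (suc k)) a b ≡ coMatchingAdj mateFin oddCorner a b
adj-M {k} a b = trans
  (cong₂ (λ paired corner → not paired ∧ not ((suc k % 2 ≡ᵇ 1) ∧ corner)) (/2≡ᵇ/2-Fin a b)
         (cong₂ _∨_ (cong₂ _∧_ (toℕ≡ᵇtoℕ a zero) (≡ᵇ-last b)) (cong₂ _∧_ (toℕ≡ᵇtoℕ b zero) (≡ᵇ-last a))))
  (sym (not-∨ (does (a ≟ b) ∨ does (b ≟ mateFin a)) (oddCorner a b)))
  where
  ≡ᵇ-last : ∀ b → (toℕ b ≡ᵇ k) ≡ does (b ≟ fromℕ k)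
  ≡ᵇ-last b = trans (cong (toℕ b ≡ᵇ_) (sym (toℕ-fromℕ k))) (toℕ≡ᵇtoℕ b (fromℕ k))

-- Conjugating an involution to the pairing

transpose-≡ˡ : ∀ {n} (i j : Fin n) → PC.transpose i j i ≡ j
transpose-≡ˡ i j rewrite dec-true (i ≟ i) refl = refl

transpose-≡ʳ : ∀ {n} (i j : Fin n) → PC.transpose i j j ≡ i
transpose-≡ʳ i j = by-cases (j ≟ i)
  where
  by-cases : Dec (j ≡ i) → PC.transpose i j j ≡ i
  by-cases (yes refl) = transpose-≡ˡ i i
  by-cases (no j≢i) rewrite dec-false (j ≟ i) j≢i | dec-true (j ≟ j) refl = refl

transpose-≢ : ∀ {n} {i j k : Fin n} → k ≢ i → k ≢ j → PC.transpose i j k ≡ k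
transpose-≢ {i = i} {j} {k} k≢i k≢j rewrite dec-false (k ≟ i) k≢i | dec-false (k ≟ j) k≢j = refl

⟨$⟩ʳ-injective : ∀ {n} (ρ : Permutation′ n) {a b} → ρ ⟨$⟩ʳ a ≡ ρ ⟨$⟩ʳ b → a ≡ b
⟨$⟩ʳ-injective ρ {a} {b} eq = trans (sym (inverseˡ ρ)) (trans (cong (ρ ⟨$⟩ˡ_) eq) (inverseˡ ρ))

∘ₚ-conjugates : ∀ {n} {p q : Fin n → Fin n} (τ ρ : Permutation′ n) → (∀ j → p (ρ ⟨$⟩ʳ j) ≡ ρ ⟨$⟩ʳ q j) →
                ∀ k → p ((τ ∘ₚ ρ) ⟨$⟩ʳ k) ≡ (τ ∘ₚ ρ) ⟨$⟩ʳ (τ ⟨$⟩ˡ q (τ ⟨$⟩ʳ k))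
∘ₚ-conjugates τ ρ conj k = trans (conj (τ ⟨$⟩ʳ k)) (cong (ρ ⟨$⟩ʳ_) (sym (inverseʳ τ)))

⟨$⟩ˡ-≡⇔ : ∀ {n} (ρ : Permutation′ n) {a w} → ρ ⟨$⟩ʳ a ≡ w → ∀ u → (ρ ⟨$⟩ˡ u ≡ a) ⇔ (u ≡ w)
⟨$⟩ˡ-≡⇔ ρ ρa≡w u = mk⇔ (λ eq → trans (sym (inverseʳ ρ)) (trans (cong (ρ ⟨$⟩ʳ_) eq) ρa≡w))
                       (λ u≡w → trans (cong (ρ ⟨$⟩ˡ_) (trans u≡w (sym ρa≡w))) (inverseˡ ρ))

module Conjugation {N : ℕ} (p : Fin (suc N) → Fin (suc N)) (p-involutive : ∀ u → p (p u) ≡ u) where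

  private
    n : ℕ
    n = suc N

  record Partial (i : ℕ) (ρ : Permutation′ n) : Set where
    field
      conj-below : ∀ k → toℕ k < double i → p (ρ ⟨$⟩ʳ k) ≡ ρ ⟨$⟩ʳ mateFin k
      moved      : ∀ k → mateFin k ≢ k → p (ρ ⟨$⟩ʳ k) ≢ ρ ⟨$⟩ʳ k
      fixed      : ∀ k → mateFin k ≡ k → p (ρ ⟨$⟩ʳ k) ≡ ρ ⟨$⟩ʳ k

  -- Swap the p-partner of ρ(2i) into position 2i+1.
  module Extend {i : ℕ} (ρ : Permutation′ n) (lt₁ : suc (double i) < n) (ρ-partial : Partial i ρ) where

    open Partial ρ-partial
    lt₀ : double i < n
    lt₀ = <-trans (n<1+n _) lt₁
    s₀ s₁ : Fin n
    s₀ = fromℕ< lt₀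
    s₁ = fromℕ< lt₁
    toℕ-s₀ : toℕ s₀ ≡ double i
    toℕ-s₀ = toℕ-fromℕ< lt₀
    toℕ-s₁ : toℕ s₁ ≡ suc (double i)
    toℕ-s₁ = toℕ-fromℕ< lt₁
    mate-s₀ : mateFin s₀ ≡ s₁
    mate-s₀ = toℕ-injective (trans (mateFin-double i s₀ toℕ-s₀ lt₁) (sym toℕ-s₁))
    mate-s₁ : mateFin s₁ ≡ s₀
    mate-s₁ = trans (cong mateFin (sym mate-s₀)) (mateFin-involutive s₀)
    s₁≢s₀ : s₁ ≢ s₀
    s₁≢s₀ eq = 1+n≢n (trans (sym toℕ-s₁) (trans (cong toℕ eq) toℕ-s₀))
    a : Fin n
    a = ρ ⟨$⟩ʳ s₀
    j : Fin n
    j = ρ ⟨$⟩ˡ p a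
    ρj : ρ ⟨$⟩ʳ j ≡ p a
    ρj = inverseʳ ρ
    pa≢a : p a ≢ a
    pa≢a = moved s₀ (s₁≢s₀ ∘ trans (sym mate-s₀))
    double<j : double i < toℕ j
    double<j with <-cmp (toℕ j) (double i)
    ... | tri> _ _ gt = gt
    ... | tri≈ _ eq _ = ⊥-elim (pa≢a (trans (sym ρj) (cong (ρ ⟨$⟩ʳ_) (toℕ-injective (trans eq (sym toℕ-s₀))))))
    ... | tri< lt _ _ = ⊥-elim (<-irrefl (trans (cong toℕ mate-j) toℕ-s₀) (mateFin-< i j lt (<⇒≤ lt₀)))
      where
      mate-j : mateFin j ≡ s₀
      mate-j = ⟨$⟩ʳ-injective ρ (trans (sym (conj-below j lt)) (trans (cong p ρj) (p-involutive a)))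
    mate-j≢j : mateFin j ≢ j
    mate-j≢j eq = pa≢a (sym (trans (sym (p-involutive a)) (trans (cong p (sym ρj)) (trans (fixed j eq) ρj))))
    ρ′ : Permutation′ n
    ρ′ = transpose s₁ j ∘ₚ ρ
    untouched : ∀ k → toℕ k ≤ double i → PC.transpose s₁ j k ≡ k
    untouched k le = transpose-≢ (λ eq → <-irrefl refl (subst (_≤ double i) (trans (cong toℕ eq) toℕ-s₁) le))
                                 (λ eq → <-irrefl refl (<-≤-trans double<j (subst (_≤ double i) (cong toℕ eq) le)))
    conj-below′ : ∀ k → toℕ k < double (suc i) → p (ρ′ ⟨$⟩ʳ k) ≡ ρ′ ⟨$⟩ʳ mateFin k
    conj-below′ k lt with <-cmp (toℕ k) (double i)
    ... | tri< lt′ _ _ rewrite untouched k (<⇒≤ lt′) | untouched (mateFin k) (<⇒≤ (mateFin-< i k lt′ (<⇒≤ lt₀))) = conj-below k lt′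
    ... | tri≈ _ eq _ rewrite toℕ-injective {i = k} {j = s₀} (trans eq (sym toℕ-s₀)) | mate-s₀ | transpose-≡ˡ s₁ j
                             | untouched s₀ (≤-reflexive toℕ-s₀) = sym ρj
    ... | tri> _ _ gt rewrite toℕ-injective {i = k} {j = s₁} (trans (≤-antisym (s≤s⁻¹ lt) gt) (sym toℕ-s₁)) | mate-s₁
                             | transpose-≡ˡ s₁ j | untouched s₀ (≤-reflexive toℕ-s₀) = trans (cong p ρj) (p-involutive a)
    moved′ : ∀ k → mateFin k ≢ k → p (ρ′ ⟨$⟩ʳ k) ≢ ρ′ ⟨$⟩ʳ k
    moved′ k mate≢ = by-cases (k ≟ s₁) (k ≟ j)
      where
      by-cases : Dec (k ≡ s₁) → Dec (k ≡ j) → p (ρ′ ⟨$⟩ʳ k) ≢ ρ′ ⟨$⟩ʳ k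
      by-cases (yes refl) _ rewrite transpose-≡ˡ s₁ j | ρj = λ eq → pa≢a (sym (trans (sym (p-involutive a)) eq))
      by-cases (no _) (yes refl) rewrite transpose-≡ʳ s₁ j = moved s₁ (λ eq → s₁≢s₀ (trans (sym eq) mate-s₁))
      by-cases (no k≢s₁) (no k≢j) rewrite transpose-≢ k≢s₁ k≢j = moved k mate≢
    fixed′ : ∀ k → mateFin k ≡ k → p (ρ′ ⟨$⟩ʳ k) ≡ ρ′ ⟨$⟩ʳ k
    fixed′ k mate≡ = by-cases (k ≟ s₁) (k ≟ j)
      where
      by-cases : Dec (k ≡ s₁) → Dec (k ≡ j) → p (ρ′ ⟨$⟩ʳ k) ≡ ρ′ ⟨$⟩ʳ k
      by-cases (yes refl) _ = ⊥-elim (s₁≢s₀ (trans (sym mate≡) mate-s₁))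
      by-cases (no _) (yes refl) = ⊥-elim (mate-j≢j mate≡)
      by-cases (no k≢s₁) (no k≢j) rewrite transpose-≢ k≢s₁ k≢j = fixed k mate≡

    ρ′-partial : Partial (suc i) ρ′
    ρ′-partial = record { conj-below = conj-below′ ; moved = moved′ ; fixed = fixed′ }

    ρ′-zero : ρ′ ⟨$⟩ʳ zero ≡ ρ ⟨$⟩ʳ zero
    ρ′-zero = cong (ρ ⟨$⟩ʳ_) (untouched zero z≤n)

  extend : ∀ {i} ρ → suc (double i) < n → Partial i ρ →
           Σ (Permutation′ n) λ ρ′ → Partial (suc i) ρ′ × ρ′ ⟨$⟩ʳ zero ≡ ρ ⟨$⟩ʳ zero
  extend ρ lt₁ ρ-partial = ρ′ , ρ′-partial , ρ′-zero
    where open Extend ρ lt₁ ρ-partial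

  iterate : ∀ ρ₀ → Partial 0 ρ₀ → ∀ i → double i ≤ n → Σ (Permutation′ n) λ ρ → Partial i ρ × ρ ⟨$⟩ʳ zero ≡ ρ₀ ⟨$⟩ʳ zero
  iterate ρ₀ ρ₀-partial zero _ = ρ₀ , ρ₀-partial , refl
  iterate ρ₀ ρ₀-partial (suc i) le with iterate ρ₀ ρ₀-partial i (≤-trans (n≤1+n _) (≤-trans (n≤1+n _) le))
  ... | ρ , ρ-partial , ρ-zero with extend ρ le ρ-partial
  ...   | ρ′ , ρ′-partial , ρ′-zero = ρ′ , ρ′-partial , trans ρ′-zero ρ-zero

  conjugate : (ρ₀ : Permutation′ n) → (∀ k → (p (ρ₀ ⟨$⟩ʳ k) ≡ ρ₀ ⟨$⟩ʳ k) ⇔ (mateFin k ≡ k)) →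
              Σ (Permutation′ n) λ ρ → (∀ k → p (ρ ⟨$⟩ʳ k) ≡ ρ ⟨$⟩ʳ mateFin k) × ρ ⟨$⟩ʳ zero ≡ ρ₀ ⟨$⟩ʳ zero
  conjugate ρ₀ fixed⇔ = from-halves (double⊎suc-double n)
    where
    ρ₀-partial : Partial 0 ρ₀
    ρ₀-partial = record
      { conj-below = λ _ ()
      ; moved = λ k mate≢ eq → mate≢ (Equivalence.to (fixed⇔ k) eq)
      ; fixed = λ k → Equivalence.from (fixed⇔ k)
      }
    from-halves : (∃ λ i → n ≡ double i ⊎ n ≡ suc (double i)) →
                  Σ (Permutation′ n) λ ρ → (∀ k → p (ρ ⟨$⟩ʳ k) ≡ ρ ⟨$⟩ʳ mateFin k) × ρ ⟨$⟩ʳ zero ≡ ρ₀ ⟨$⟩ʳ zero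
    from-halves (i , inj₁ n≡) with iterate ρ₀ ρ₀-partial i (≤-reflexive (sym n≡))
    ... | ρ , ρ-partial , ρ-zero = ρ , (λ k → Partial.conj-below ρ-partial k (subst (toℕ k <_) n≡ (toℕ<n k))) , ρ-zero
    from-halves (i , inj₂ n≡) with iterate ρ₀ ρ₀-partial i (subst (double i ≤_) (sym n≡) (n≤1+n _))
    ... | ρ , ρ-partial , ρ-zero = ρ , conj , ρ-zero
      where
      conj : ∀ k → p (ρ ⟨$⟩ʳ k) ≡ ρ ⟨$⟩ʳ mateFin k
      conj k with toℕ k <? double i
      ... | yes lt = Partial.conj-below ρ-partial k lt
      ... | no ≮ = trans (Partial.fixed ρ-partial k mate≡) (cong (ρ ⟨$⟩ʳ_) (sym mate≡))
        where
        mate≡ : mateFin k ≡ k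
        mate≡ = mateFin-suc-double i k (≤-antisym (s≤s⁻¹ (subst (toℕ k <_) n≡ (toℕ<n k))) (≮⇒≥ ≮)) n≡

conjugate-even : ∀ {N} (p : Fin (suc N) → Fin (suc N)) → (∀ u → p (p u) ≡ u) → (∀ u → p u ≢ u) → suc N % 2 ≡ 0 →
                 Σ (Permutation′ (suc N)) λ ρ → ∀ k → p (ρ ⟨$⟩ʳ k) ≡ ρ ⟨$⟩ʳ mateFin k
conjugate-even p p-involutive p-no-fixed even =
  map₂ proj₁ (Conjugation.conjugate p p-involutive Perm.id λ k → mk⇔ (⊥-elim ∘ p-no-fixed k) (⊥-elim ∘ mateFin-no-fixed even k))

conjugate-odd : ∀ {k} (p : Fin (suc k) → Fin (suc k)) → (∀ u → p (p u) ≡ u) →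
                ∀ {b c} → p b ≡ b → (∀ u → p u ≡ u → u ≡ b) → c ≢ b → suc k % 2 ≡ 1 → 1 ≤ k →
                Σ (Permutation′ (suc k)) λ ρ → (∀ j → p (ρ ⟨$⟩ʳ j) ≡ ρ ⟨$⟩ʳ mateFin j) × ρ ⟨$⟩ʳ zero ≡ c × ρ ⟨$⟩ʳ fromℕ k ≡ b
conjugate-odd {k} p p-involutive {b} {c} pb≡b fixed⇒b c≢b odd 1≤k = case Conjugation.conjugate p p-involutive ρ₀ fixed⇔ of λ
  { (ρ , conj , ρ-zero) → ρ , conj , trans ρ-zero ρ₀-zero , fixed⇒b _ (trans (conj (fromℕ k)) (cong (ρ ⟨$⟩ʳ_) (mateFin-last odd))) }
  where
  last : Fin (suc k)
  last = fromℕ k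
  b′ : Fin (suc k)
  b′ = PC.transpose c zero b
  ρ₀ : Permutation′ (suc k)
  ρ₀ = transpose last b′ ∘ₚ transpose zero c
  ρ₀-last : ρ₀ ⟨$⟩ʳ last ≡ b
  ρ₀-last = trans (cong (PC.transpose zero c) (transpose-≡ˡ last b′)) (PC.transpose-inverse zero c)
  zero≢last : zero ≢ last
  zero≢last eq = <-irrefl (trans (cong toℕ eq) (toℕ-fromℕ k)) 1≤k
  zero≢b′ : zero ≢ b′
  zero≢b′ eq = c≢b (trans (sym (transpose-≡ˡ zero c)) (trans (cong (PC.transpose zero c) eq) (PC.transpose-inverse zero c)))
  ρ₀-zero : ρ₀ ⟨$⟩ʳ zero ≡ c
  ρ₀-zero = trans (cong (PC.transpose zero c) (transpose-≢ zero≢last zero≢b′)) (transpose-≡ˡ zero c)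
  fixed⇔ : ∀ j → (p (ρ₀ ⟨$⟩ʳ j) ≡ ρ₀ ⟨$⟩ʳ j) ⇔ (mateFin j ≡ j)
  fixed⇔ j = mk⇔ (λ fixed → subst (λ z → mateFin z ≡ z) (sym (j≡last fixed)) (mateFin-last odd))
                 (λ mate≡ → subst (λ z → p (ρ₀ ⟨$⟩ʳ z) ≡ ρ₀ ⟨$⟩ʳ z) (sym (proj₁ (mateFin-fixed⇒last j mate≡)))
                                  (trans (cong p ρ₀-last) (trans pb≡b (sym ρ₀-last))))
    where
    j≡last : p (ρ₀ ⟨$⟩ʳ j) ≡ ρ₀ ⟨$⟩ʳ j → j ≡ last
    j≡last fixed = ⟨$⟩ʳ-injective ρ₀ (trans (fixed⇒b _ fixed) (sym ρ₀-last))

-- Graphs of minimal total defect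

module _ {n : ℕ} (G : Graph n) where

  codegree≡2-unique : ∀ {v} → codegree G v ≡ 2 → ∀ {w w′} → w ≢ v → adj G v w ≡ false → w′ ≢ v → adj G v w′ ≡ false → w ≡ w′
  codegree≡2-unique {v} c≡2 {w} {w′} w≢v vw w′≢v vw′ with w ≟ w′
  ... | yes w≡w′ = w≡w′
  ... | no w≢w′ = ⊥-elim (<-irrefl refl (begin-strict
    2                                               <⟨ s≤s (s≤s (s≤s z≤n)) ⟩
    3                                               ≡⟨ three ⟨
    nonadj G v v + (nonadj G v w + nonadj G v w′)   ≤⟨ +-+-≤-sum (nonadj G v) w≢v w′≢v (w≢w′ ∘ sym) ⟩
    codegree G v                                    ≡⟨ c≡2 ⟩
    2                                               ∎))
    where
    open ≤-Reasoning
    three : nonadj G v v + (nonadj G v w + nonadj G v w′) ≡ 3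
    three rewrite nonadj-self G v | nonadj-false G vw | nonadj-false G vw′ = refl

  codegree≡3-two : ∀ {v} → codegree G v ≡ 3 → ∀ {a b w} → a ≢ v → b ≢ v → b ≢ a → adj G v a ≡ false → adj G v b ≡ false →
                   w ≢ v → adj G v w ≡ false → w ≡ a ⊎ w ≡ b
  codegree≡3-two {v} c≡3 {a} {b} {w} a≢v b≢v b≢a va vb w≢v vw with w ≟ a | w ≟ b
  ... | yes w≡a | _ = inj₁ w≡a
  ... | no _ | yes w≡b = inj₂ w≡b
  ... | no w≢a | no w≢b = ⊥-elim (<-irrefl refl (begin-strict
    3                                                    <⟨ n<1+n 3 ⟩
    4                                                    ≡⟨ four ⟨
    nonadj G v v + (F a + (F b + F w))                   ≤⟨ +-monoʳ-≤ (nonadj G v v) (+-+-≤-sum F b≢a w≢a w≢b) ⟩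
    nonadj G v v + sum F                                 ≡⟨ sum-erase (nonadj G v) v ⟨
    codegree G v                                         ≡⟨ c≡3 ⟩
    3                                                    ∎))
    where
    open ≤-Reasoning
    F : Fin n → ℕ
    F = erase v (nonadj G v)
    four : nonadj G v v + (F a + (F b + F w)) ≡ 4
    four rewrite nonadj-self G v | erase-≢ (nonadj G v) a≢v | erase-≢ (nonadj G v) b≢v | erase-≢ (nonadj G v) w≢v
               | nonadj-false G va | nonadj-false G vb | nonadj-false G vw = refl

  private
    true≢false : true ≢ false
    true≢false ()

  coMatchingAdj-from : (p : Fin n → Fin n) (E : Fin n → Fin n → Bool) →
    (∀ {u v} → adj G u v ≡ false → u ≡ v ⊎ v ≡ p u ⊎ E u v ≡ true) →
    (∀ u → adj G u (p u) ≡ false) → (∀ {u v} → E u v ≡ true → adj G u v ≡ false) →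
    ∀ u v → adj G u v ≡ coMatchingAdj p E u v
  coMatchingAdj-from p E nonadj⇒ p-nonadj E-nonadj u v with adj G u v in uv | u ≟ v | v ≟ p u | E u v in Euv
  ... | true | yes refl | _ | _ = ⊥-elim (true≢false (trans (sym uv) (irrefl G u)))
  ... | true | no _ | yes refl | _ = ⊥-elim (true≢false (trans (sym uv) (p-nonadj u)))
  ... | true | no _ | no _ | true = ⊥-elim (true≢false (trans (sym uv) (E-nonadj Euv)))
  ... | true | no _ | no _ | false = refl
  ... | false | yes _ | _ | _ = refl
  ... | false | no _ | yes _ | _ = refl
  ... | false | no _ | no _ | true = refl
  ... | false | no u≢v | no v≢pu | false with nonadj⇒ uv
  ...   | inj₁ u≡v = ⊥-elim (u≢v u≡v)
  ...   | inj₂ (inj₁ v≡pu) = ⊥-elim (v≢pu v≡pu)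
  ...   | inj₂ (inj₂ E≡true) = ⊥-elim (true≢false (trans (sym E≡true) Euv))

  codegree≡2-nonadj : ∀ {u w} → codegree G u ≡ 2 → w ≢ u → adj G u w ≡ false → ∀ {v} → adj G u v ≡ false → u ≡ v ⊎ v ≡ w
  codegree≡2-nonadj {u} c≡2 w≢u uw {v} uv with u ≟ v
  ... | yes u≡v = inj₁ u≡v
  ... | no u≢v = inj₂ (codegree≡2-unique c≡2 (u≢v ∘ sym) uv w≢u uw)

  nonneighbour-other : ∀ {v a} → 3 ≤ codegree G v → a ≢ v → adj G v a ≡ false → ∃ λ b → b ≢ v × b ≢ a × adj G v b ≡ false
  nonneighbour-other {v} {a} 3≤c a≢v va = case sum-pos-elsewhere F a F-a<sum of λ
    { (b , b≢a , pos) → b , erase-pos⇒≢ (nonadj G v) pos , b≢a , nonadj-pos G (subst (0 <_) (erase-≢ (nonadj G v) (erase-pos⇒≢ (nonadj G v) pos)) pos) }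
    where
    F : Fin n → ℕ
    F = erase v (nonadj G v)
    F-a<sum : F a < sum F
    F-a<sum = begin-strict
      F a           ≡⟨ trans (erase-≢ (nonadj G v) a≢v) (nonadj-false G va) ⟩
      1             <⟨ s≤s (s≤s z≤n) ⟩
      2             ≤⟨ ∸-monoˡ-≤ 1 3≤c ⟩
      codegree G v ∸ 1 ≡⟨ cong (_∸ 1) (trans (sum-erase (nonadj G v) v) (cong (_+ sum F) (nonadj-self G v))) ⟩
      sum F         ∎
      where open ≤-Reasoning

oddCorner-even : ∀ {k} → suc k % 2 ≡ 0 → ∀ (a b : Fin (suc k)) → oddCorner a b ≡ false
oddCorner-even {k} even a b = cong (λ r → (r ≡ᵇ 1) ∧ ((does (a ≟ zero) ∧ does (b ≟ fromℕ k)) ∨ (does (b ≟ zero) ∧ does (a ≟ fromℕ k)))) even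

oddCorner-odd : ∀ {k} → suc k % 2 ≡ 1 → ∀ (a b : Fin (suc k)) →
                oddCorner a b ≡ (does (a ≟ zero) ∧ does (b ≟ fromℕ k)) ∨ (does (b ≟ zero) ∧ does (a ≟ fromℕ k))
oddCorner-odd {k} odd a b = cong (λ r → (r ≡ᵇ 1) ∧ ((does (a ≟ zero) ∧ does (b ≟ fromℕ k)) ∨ (does (b ≟ zero) ∧ does (a ≟ fromℕ k)))) odd

codegree≡2⇒≃M : ∀ {k} (G : Graph (suc k)) → suc k % 2 ≡ 0 → (∀ v → codegree G v ≡ 2) → G ≃ M (suc k)
codegree≡2⇒≃M {k} G even c≡2 =
  coMatching-≃ adj-G adj-M (proj₁ ρ-conj) (proj₂ ρ-conj) (λ u v → oddCorner-even even (proj₁ ρ-conj ⟨$⟩ˡ u) (proj₁ ρ-conj ⟨$⟩ˡ v))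
  where
  nonneighbour₂ : ∀ v → ∃ λ w → w ≢ v × adj G v w ≡ false
  nonneighbour₂ v = nonneighbour G (≤-reflexive (sym (c≡2 v)))
  p : Fin (suc k) → Fin (suc k)
  p v = proj₁ (nonneighbour₂ v)
  p≢ : ∀ v → p v ≢ v
  p≢ v = proj₁ (proj₂ (nonneighbour₂ v))
  p-nonadj : ∀ v → adj G v (p v) ≡ false
  p-nonadj v = proj₂ (proj₂ (nonneighbour₂ v))
  p-involutive : ∀ v → p (p v) ≡ v
  p-involutive v = codegree≡2-unique G (c≡2 (p v)) (p≢ (p v)) (p-nonadj (p v)) (p≢ v ∘ sym) (nonadj-sym G (p-nonadj v))
  adj-G : ∀ u v → adj G u v ≡ coMatchingAdj p (λ _ _ → false) u v
  adj-G = coMatchingAdj-from G p (λ _ _ → false) (λ {u} uv → ⊎-map₂ inj₁ (codegree≡2-nonadj G (c≡2 u) (p≢ u) (p-nonadj u) uv))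
                             p-nonadj (λ ())
  ρ-conj : Σ (Permutation′ (suc k)) λ ρ → ∀ j → p (ρ ⟨$⟩ʳ j) ≡ ρ ⟨$⟩ʳ mateFin j
  ρ-conj = conjugate-even p p-involutive p≢ even

module OddCase {k : ℕ} (G : Graph (suc k)) (odd : suc k % 2 ≡ 1) (1≤k : 1 ≤ k) {c : Fin (suc k)} (c≡3 : codegree G c ≡ 3)
  (c≡2 : ∀ {v} → v ≢ c → codegree G v ≡ 2) {a₀ b₀ : Fin (suc k)} (a₀≢c : a₀ ≢ c) (b₀≢c : b₀ ≢ c) (b₀≢a₀ : b₀ ≢ a₀)
  (ca₀ : adj G c a₀ ≡ false) (cb₀ : adj G c b₀ ≡ false) where

  nonadj-c : ∀ {w} → w ≢ c → adj G c w ≡ false → w ≡ a₀ ⊎ w ≡ b₀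
  nonadj-c = codegree≡3-two G c≡3 a₀≢c b₀≢c b₀≢a₀ ca₀ cb₀
  unique : ∀ {u} → u ≢ c → ∀ {w w′} → w ≢ u → adj G u w ≡ false → w′ ≢ u → adj G u w′ ≡ false → w ≡ w′
  unique u≢c = codegree≡2-unique G (c≡2 u≢c)
  nonneighbour₂ : ∀ {v} → v ≢ c → ∃ λ w → w ≢ v × adj G v w ≡ false
  nonneighbour₂ v≢c = nonneighbour G (≤-reflexive (sym (c≡2 v≢c)))

  -- c is paired with a₀, and b₀ is the fixed point; the non-edge c b₀ becomes the odd corner
  p : Fin (suc k) → Fin (suc k)
  p u = choose (u ≟ c) (u ≟ b₀)
    where
    choose : Dec (u ≡ c) → Dec (u ≡ b₀) → Fin (suc k)
    choose (yes _) _ = a₀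
    choose (no _) (yes _) = b₀
    choose (no u≢c) (no _) = proj₁ (nonneighbour₂ u≢c)
  p-c : p c ≡ a₀
  p-c rewrite proj₂ (dec-yes (c ≟ c) refl) = refl
  p-b₀ : p b₀ ≡ b₀
  p-b₀ rewrite dec-no (b₀ ≟ c) b₀≢c | proj₂ (dec-yes (b₀ ≟ b₀) refl) = refl
  p-other : ∀ {u} → u ≢ c → u ≢ b₀ → p u ≢ u × adj G u (p u) ≡ false
  p-other {u} u≢c u≢b₀ rewrite dec-no (u ≟ c) u≢c | dec-no (u ≟ b₀) u≢b₀ = proj₂ (nonneighbour₂ u≢c)
  p-a₀ : p a₀ ≡ c
  p-a₀ = unique a₀≢c (proj₁ (p-other a₀≢c (b₀≢a₀ ∘ sym))) (proj₂ (p-other a₀≢c (b₀≢a₀ ∘ sym))) (a₀≢c ∘ sym) (nonadj-sym G ca₀)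
  nonadj-b₀ : ∀ {v} → adj G b₀ v ≡ false → b₀ ≡ v ⊎ v ≡ c
  nonadj-b₀ = codegree≡2-nonadj G (c≡2 b₀≢c) (b₀≢c ∘ sym) (nonadj-sym G cb₀)

  p-involutive : ∀ u → p (p u) ≡ u
  p-involutive u = cases u (u ≟ c) (u ≟ b₀) (u ≟ a₀)
    where
    cases : ∀ u → Dec (u ≡ c) → Dec (u ≡ b₀) → Dec (u ≡ a₀) → p (p u) ≡ u
    cases _ (yes refl) _ _ = trans (cong p p-c) p-a₀
    cases _ (no _) (yes refl) _ = trans (cong p p-b₀) p-b₀
    cases _ (no _) (no _) (yes refl) = trans (cong p p-a₀) p-c
    cases u (no u≢c) (no u≢b₀) (no u≢a₀) = unique w≢c (proj₁ (p-other w≢c w≢b₀)) (proj₂ (p-other w≢c w≢b₀)) (w≢u ∘ sym) (nonadj-sym G uw)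
      where
      w≢u : p u ≢ u
      w≢u = proj₁ (p-other u≢c u≢b₀)
      uw : adj G u (p u) ≡ false
      uw = proj₂ (p-other u≢c u≢b₀)
      w≢c : p u ≢ c
      w≢c w≡c = [ u≢a₀ , u≢b₀ ]′ (nonadj-c u≢c (subst (λ z → adj G z u ≡ false) w≡c (nonadj-sym G uw)))
      w≢b₀ : p u ≢ b₀
      w≢b₀ w≡b₀ = [ (λ b₀≡u → u≢b₀ (sym b₀≡u)) , u≢c ]′ (nonadj-b₀ (subst (λ z → adj G z u ≡ false) w≡b₀ (nonadj-sym G uw)))

  fixed⇒b₀ : ∀ u → p u ≡ u → u ≡ b₀
  fixed⇒b₀ u = cases u (u ≟ c) (u ≟ b₀)
    where
    cases : ∀ u → Dec (u ≡ c) → Dec (u ≡ b₀) → p u ≡ u → u ≡ b₀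
    cases _ (yes refl) _ pc≡c = ⊥-elim (a₀≢c (trans (sym p-c) pc≡c))
    cases _ (no _) (yes u≡b₀) _ = u≡b₀
    cases u (no u≢c) (no u≢b₀) pu≡u = ⊥-elim (proj₁ (p-other u≢c u≢b₀) pu≡u)

  E : Fin (suc k) → Fin (suc k) → Bool
  E u v = (does (u ≟ c) ∧ does (v ≟ b₀)) ∨ (does (v ≟ c) ∧ does (u ≟ b₀))

  p-nonadj : ∀ u → adj G u (p u) ≡ false
  p-nonadj u = cases u (u ≟ c) (u ≟ b₀)
    where
    cases : ∀ u → Dec (u ≡ c) → Dec (u ≡ b₀) → adj G u (p u) ≡ false
    cases _ (yes refl) _ = trans (cong (adj G c) p-c) ca₀
    cases _ (no _) (yes refl) = trans (cong (adj G b₀) p-b₀) (irrefl G b₀)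
    cases u (no u≢c) (no u≢b₀) = proj₂ (p-other u≢c u≢b₀)

  E-nonadj : ∀ {u v} → E u v ≡ true → adj G u v ≡ false
  E-nonadj {u} {v} Euv with does (u ≟ c) ∧ does (v ≟ b₀) in corner
  ... | true = subst₂ (λ x y → adj G x y ≡ false) (sym (does≡true (u ≟ c) (proj₁ (∧≡true corner))))
                                                  (sym (does≡true (v ≟ b₀) (proj₂ (∧≡true corner)))) cb₀
  ... | false = subst₂ (λ x y → adj G x y ≡ false) (sym (does≡true (u ≟ b₀) (proj₂ (∧≡true Euv))))
                                                   (sym (does≡true (v ≟ c) (proj₁ (∧≡true Euv)))) (nonadj-sym G cb₀)

  nonadj⇒ : ∀ {u v} → adj G u v ≡ false → u ≡ v ⊎ v ≡ p u ⊎ E u v ≡ true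
  nonadj⇒ {u} {v} = cases u v (u ≟ v) (u ≟ c) (u ≟ b₀)
    where
    cases : ∀ u v → Dec (u ≡ v) → Dec (u ≡ c) → Dec (u ≡ b₀) → adj G u v ≡ false → u ≡ v ⊎ v ≡ p u ⊎ E u v ≡ true
    cases u v (yes u≡v) _ _ _ = inj₁ u≡v
    cases _ v (no c≢v) (yes refl) _ cv with nonadj-c (c≢v ∘ sym) cv
    ... | inj₁ refl = inj₂ (inj₁ (sym p-c))
    ... | inj₂ refl rewrite dec-true (c ≟ c) refl | dec-true (b₀ ≟ b₀) refl = inj₂ (inj₂ refl)
    cases _ v (no b₀≢v) (no _) (yes refl) b₀v with nonadj-b₀ b₀v
    ... | inj₁ b₀≡v = ⊥-elim (b₀≢v b₀≡v)
    ... | inj₂ refl rewrite dec-true (c ≟ c) refl | dec-true (b₀ ≟ b₀) refl = inj₂ (inj₂ (∨-zeroʳ _))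
    cases u v (no u≢v) (no u≢c) (no u≢b₀) uv =
      inj₂ (inj₁ ([ (λ u≡v → ⊥-elim (u≢v u≡v)) , (λ v≡pu → v≡pu) ]′
                   (codegree≡2-nonadj G (c≡2 u≢c) (proj₁ (p-other u≢c u≢b₀)) (proj₂ (p-other u≢c u≢b₀)) uv)))

  adj-G : ∀ u v → adj G u v ≡ coMatchingAdj p E u v
  adj-G = coMatchingAdj-from G p E nonadj⇒ p-nonadj E-nonadj

  ρ-conj : Σ (Permutation′ (suc k)) λ ρ → (∀ j → p (ρ ⟨$⟩ʳ j) ≡ ρ ⟨$⟩ʳ mateFin j) × ρ ⟨$⟩ʳ zero ≡ c × ρ ⟨$⟩ʳ fromℕ k ≡ b₀
  ρ-conj = conjugate-odd p p-involutive p-b₀ fixed⇒b₀ (b₀≢c ∘ sym) odd 1≤k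
  ρ : Permutation′ (suc k)
  ρ = proj₁ ρ-conj

  F≡E : ∀ u v → oddCorner (ρ ⟨$⟩ˡ u) (ρ ⟨$⟩ˡ v) ≡ E u v
  F≡E u v = trans (oddCorner-odd odd (ρ ⟨$⟩ˡ u) (ρ ⟨$⟩ˡ v))
    (cong₂ _∨_ (cong₂ _∧_ (at-zero u) (at-last v)) (cong₂ _∧_ (at-zero v) (at-last u)))
    where
    at-zero : ∀ u → does (ρ ⟨$⟩ˡ u ≟ zero) ≡ does (u ≟ c)
    at-zero u = does-⇔ (⟨$⟩ˡ-≡⇔ ρ (proj₁ (proj₂ (proj₂ ρ-conj))) u) (ρ ⟨$⟩ˡ u ≟ zero) (u ≟ c)
    at-last : ∀ u → does (ρ ⟨$⟩ˡ u ≟ fromℕ k) ≡ does (u ≟ b₀)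
    at-last u = does-⇔ (⟨$⟩ˡ-≡⇔ ρ (proj₂ (proj₂ (proj₂ ρ-conj))) u) (ρ ⟨$⟩ˡ u ≟ fromℕ k) (u ≟ b₀)

  ≃M : G ≃ M (suc k)
  ≃M = coMatching-≃ adj-G adj-M ρ (proj₁ (proj₂ ρ-conj)) F≡E

codegree≡3⇒≃M : ∀ {k} (G : Graph (suc k)) → suc k % 2 ≡ 1 → 1 ≤ k → ∀ {c} → codegree G c ≡ 3 →
                (∀ {v} → v ≢ c → codegree G v ≡ 2) → G ≃ M (suc k)
codegree≡3⇒≃M G odd 1≤k c≡3 c≡2 = case nonneighbour G (≤-trans (n≤1+n 2) (≤-reflexive (sym c≡3))) of λ
  { (a₀ , a₀≢c , ca₀) → case nonneighbour-other G (≤-reflexive (sym c≡3)) a₀≢c ca₀ of λ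
    { (b₀ , b₀≢c , b₀≢a₀ , cb₀) → OddCase.≃M G odd 1≤k c≡3 c≡2 a₀≢c b₀≢c b₀≢a₀ ca₀ cb₀ } }

-- Relabelling the rim of H₁ by swapping 1 and 2 turns it into K₅ minus the matching {01, 23}.
hubMate : Fin 5 → Fin 5
hubMate k = transpose 1F 2F ⟨$⟩ˡ mateFin (transpose 1F 2F ⟨$⟩ʳ k)

adj-H₁ : ∀ a b → adj H₁ a b ≡ coMatchingAdj hubMate (λ _ _ → false) a b
adj-H₁ = toWitness {a? = all? λ a → all? λ b → adj H₁ a b Bool.≟ coMatchingAdj hubMate (λ _ _ → false) a b} _

module HubCase (G : Graph 5) {h : Fin 5} (h≡1 : codegree G h ≡ 1) (c≡2 : ∀ {v} → v ≢ h → codegree G v ≡ 2) where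

  nonneighbour₂ : ∀ {v} → v ≢ h → ∃ λ w → w ≢ v × adj G v w ≡ false
  nonneighbour₂ v≢h = nonneighbour G (≤-reflexive (sym (c≡2 v≢h)))

  p : Fin 5 → Fin 5
  p u = choose (u ≟ h)
    where
    choose : Dec (u ≡ h) → Fin 5
    choose (yes _) = h
    choose (no u≢h) = proj₁ (nonneighbour₂ u≢h)
  p-h : p h ≡ h
  p-h rewrite proj₂ (dec-yes (h ≟ h) refl) = refl
  p-other : ∀ {u} → u ≢ h → p u ≢ u × adj G u (p u) ≡ false
  p-other {u} u≢h rewrite dec-no (u ≟ h) u≢h = proj₂ (nonneighbour₂ u≢h)
  p-nonadj : ∀ u → adj G u (p u) ≡ false
  p-nonadj u = cases u (u ≟ h)
    where
    cases : ∀ u → Dec (u ≡ h) → adj G u (p u) ≡ false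
    cases _ (yes refl) = trans (cong (adj G h) p-h) (irrefl G h)
    cases u (no u≢h) = proj₂ (p-other u≢h)

  hub-adj : ∀ {u} → u ≢ h → adj G u h ≡ true
  hub-adj {u} u≢h = trans (adj-sym G u h) (codegree≡1⇒adj G h≡1 u≢h)

  p-involutive : ∀ u → p (p u) ≡ u
  p-involutive u = cases u (u ≟ h)
    where
    cases : ∀ u → Dec (u ≡ h) → p (p u) ≡ u
    cases _ (yes refl) = trans (cong p p-h) p-h
    cases u (no u≢h) = codegree≡2-unique G (c≡2 w≢h) (proj₁ (p-other w≢h)) (proj₂ (p-other w≢h))
                                         (proj₁ (p-other u≢h) ∘ sym) (nonadj-sym G (proj₂ (p-other u≢h)))
      where
      w≢h : p u ≢ h
      w≢h w≡h with trans (sym (hub-adj u≢h)) (subst (λ z → adj G u z ≡ false) w≡h (proj₂ (p-other u≢h)))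
      ... | ()

  fixed⇒h : ∀ u → p u ≡ u → u ≡ h
  fixed⇒h u = cases u (u ≟ h)
    where
    cases : ∀ u → Dec (u ≡ h) → p u ≡ u → u ≡ h
    cases _ (yes u≡h) _ = u≡h
    cases u (no u≢h) pu≡u = ⊥-elim (proj₁ (p-other u≢h) pu≡u)

  nonadj⇒ : ∀ {u v} → adj G u v ≡ false → u ≡ v ⊎ v ≡ p u ⊎ false ≡ true
  nonadj⇒ {u} {v} = cases u v (u ≟ v) (u ≟ h)
    where
    cases : ∀ u v → Dec (u ≡ v) → Dec (u ≡ h) → adj G u v ≡ false → u ≡ v ⊎ v ≡ p u ⊎ false ≡ true
    cases u v (yes u≡v) _ _ = inj₁ u≡v
    cases _ v (no h≢v) (yes refl) hv with trans (sym (codegree≡1⇒adj G h≡1 (h≢v ∘ sym))) hv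
    ... | ()
    cases u v (no u≢v) (no u≢h) uv =
      inj₂ (inj₁ ([ (λ u≡v → ⊥-elim (u≢v u≡v)) , (λ v≡pu → v≡pu) ]′
                   (codegree≡2-nonadj G (c≡2 u≢h) (proj₁ (p-other u≢h)) (proj₂ (p-other u≢h)) uv)))

  ρ-conj : Σ (Permutation′ 5) λ ρ → (∀ j → p (ρ ⟨$⟩ʳ j) ≡ ρ ⟨$⟩ʳ mateFin j) × ρ ⟨$⟩ʳ zero ≡ another h × ρ ⟨$⟩ʳ fromℕ 4 ≡ h
  ρ-conj = conjugate-odd p p-involutive p-h fixed⇒h (another≢ h) refl (s≤s z≤n)

  ≃H₁ : G ≃ H₁
  ≃H₁ = coMatching-≃ adj-G adj-H₁ (transpose 1F 2F ∘ₚ proj₁ ρ-conj)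
                     (∘ₚ-conjugates {p = p} {q = mateFin} (transpose 1F 2F) (proj₁ ρ-conj) (proj₁ (proj₂ ρ-conj))) (λ _ _ → refl)
    where
    adj-G : ∀ u v → adj G u v ≡ coMatchingAdj p (λ _ _ → false) u v
    adj-G = coMatchingAdj-from G p (λ _ _ → false) nonadj⇒ p-nonadj (λ ())

-- The extremal graphs attain the bound

module _ {k : ℕ} (1≤k : 1 ≤ k) where

  private
    n : ℕ
    n = suc k
    last : Fin n
    last = fromℕ k
    zero≢last : zero ≢ last
    zero≢last eq = <-irrefl (trans (cong toℕ eq) (toℕ-fromℕ k)) 1≤k

  nonadj-M-mate : ∀ a → nonadj (M n) a (mateFin a) ≡ 1
  nonadj-M-mate a rewrite adj-M a (mateFin a) | dec-true (mateFin a ≟ mateFin a) refl | ∨-zeroʳ (does (a ≟ mateFin a)) = refl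

  nonadj-M-elsewhere : ∀ {a w} → w ≢ a → w ≢ mateFin a → oddCorner a w ≡ false → nonadj (M n) a w ≡ 0
  nonadj-M-elsewhere {a} {w} w≢a w≢mate corner rewrite adj-M a w | dec-false (a ≟ w) (w≢a ∘ sym) | dec-false (w ≟ mateFin a) w≢mate | corner = refl

  codegree-M-even : suc k % 2 ≡ 0 → ∀ a → codegree (M n) a ≡ 2
  codegree-M-even even a = sum-two-points (nonadj (M n) a) (mateFin-no-fixed even a) (nonadj-self (M n) a) (nonadj-M-mate a)
    (λ w w≢a w≢mate → nonadj-M-elsewhere w≢a w≢mate (oddCorner-even even a w))

  codegree-M-middle : suc k % 2 ≡ 1 → ∀ {a} → a ≢ zero → a ≢ last → codegree (M n) a ≡ 2
  codegree-M-middle odd {a} a≢zero a≢last = sum-two-points (nonadj (M n) a) (a≢last ∘ proj₁ ∘ mateFin-fixed⇒last a)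
    (nonadj-self (M n) a) (nonadj-M-mate a) (λ w w≢a w≢mate → nonadj-M-elsewhere w≢a w≢mate (off w))
    where
    off : ∀ w → oddCorner a w ≡ false
    off w rewrite oddCorner-odd odd a w | dec-false (a ≟ zero) a≢zero | dec-false (a ≟ last) a≢last = ∧-zeroʳ (does (w ≟ zero))

  codegree-M-last : suc k % 2 ≡ 1 → codegree (M n) last ≡ 2
  codegree-M-last odd = sum-two-points (nonadj (M n) last) zero≢last (nonadj-self (M n) last) last-zero rest
    where
    last-zero : nonadj (M n) last zero ≡ 1
    last-zero rewrite adj-M last zero | oddCorner-odd odd last zero | dec-true (last ≟ last) refl
                    | ∨-zeroʳ (does (last ≟ zero) ∧ does (zero ≟ last)) | ∨-zeroʳ (does (last ≟ zero) ∨ does (zero ≟ mateFin last)) = refl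
    rest : ∀ w → w ≢ last → w ≢ zero → nonadj (M n) last w ≡ 0
    rest w w≢last w≢zero = nonadj-M-elsewhere w≢last (subst (w ≢_) (sym (mateFin-last odd)) w≢last) off
      where
      off : oddCorner last w ≡ false
      off rewrite oddCorner-odd odd last w | dec-false (last ≟ zero) (zero≢last ∘ sym) | dec-false (w ≟ zero) w≢zero = refl

  codegree-M-zero : suc k % 2 ≡ 1 → codegree (M n) zero ≡ 3
  codegree-M-zero odd = sum-three-points (nonadj (M n) zero) (mate≢zero ∘ sym ∘ sym) (zero≢last ∘ sym) (mate≢last ∘ sym)
    (nonadj-self (M n) zero) (nonadj-M-mate zero) zero-last rest
    where
    mate≢zero : mateFin zero ≢ zero
    mate≢zero = zero≢last ∘ proj₁ ∘ mateFin-fixed⇒last zero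
    mate≢last : mateFin zero ≢ last
    mate≢last eq = zero≢last (trans (sym (mateFin-involutive zero)) (trans (cong mateFin eq) (mateFin-last odd)))
    zero-last : nonadj (M n) zero last ≡ 1
    zero-last rewrite adj-M zero last | oddCorner-odd odd zero last | dec-true (last ≟ last) refl
                    | ∨-zeroʳ (does (zero ≟ last) ∨ does (last ≟ mateFin zero)) = refl
    rest : ∀ w → w ≢ zero → w ≢ mateFin zero → w ≢ last → nonadj (M n) zero w ≡ 0
    rest w w≢zero w≢mate w≢last = nonadj-M-elsewhere w≢zero w≢mate off
      where
      off : oddCorner zero w ≡ false
      off rewrite oddCorner-odd odd zero w | dec-false (w ≟ last) w≢last | dec-false (w ≟ zero) w≢zero = refl

  ∑defect-M : sum (defect (M n)) ≡ 2 * (n % 2)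
  ∑defect-M with %2≡0⊎%2≡1 n
  ... | inj₁ even = trans (sum-zero (defect (M n)) λ a → cong (λ c → defectOf n (c ∸ 1)) (codegree-M-even even a)) (cong (2 *_) (sym even))
  ... | inj₂ odd = trans (sum-erase (defect (M n)) zero)
                         (trans (cong₂ _+_ (cong (λ c → defectOf n (c ∸ 1)) (codegree-M-zero odd)) (sum-zero (erase zero (defect (M n))) others))
                                (cong (2 *_) (sym odd)))
    where
    others : ∀ w → erase zero (defect (M n)) w ≡ 0
    others w with w ≟ zero | w ≟ last
    ... | yes _ | _ = refl
    ... | no w≢zero | yes refl = cong (λ c → defectOf n (c ∸ 1)) (codegree-M-last odd)
    ... | no w≢zero | no w≢last = cong (λ c → defectOf n (c ∸ 1)) (codegree-M-middle odd w≢zero w≢last)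

module _ {n : ℕ} {G T : Graph n} (G≃T : G ≃ T) where

  private
    σ : Fin n → Fin n
    σ = Inverse.to (_≃_.bij G≃T)

  codegree-≃ : ∀ u → codegree G u ≡ codegree T (σ u)
  codegree-≃ u = trans (sum-cong-≗ λ w → cong (λ b → if b then 0 else 1) (sym (_≃_.preserve G≃T u w)))
                       (sym (sum-permute (nonadj T (σ u)) (_≃_.bij G≃T)))

  ∑defect-≃ : sum (defect G) ≡ sum (defect T)
  ∑defect-≃ = trans (sum-cong-≗ λ u → cong (λ c → defectOf n (c ∸ 1)) (codegree-≃ u)) (sym (sum-permute (defect T) (_≃_.bij G≃T)))

module _ {m : ℕ} (G : Graph (suc (suc m))) (2≤m : 2 ≤ m) where

  private
    n : ℕ
    n = suc (suc m)

  defect≡0⇒codegree≡2 : ∀ {v} → defect G v ≡ 0 → codegree G v ≡ 2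
  defect≡0⇒codegree≡2 {v} d≡0 with codegree G v in c≡
  ... | zero = ⊥-elim (<-irrefl refl (subst (1 ≤_) c≡ (1≤codegree G v)))
  ... | suc zero = ⊥-elim (<-irrefl refl (subst (1 ≤_) d≡0 (∸-monoˡ-≤ 1 2≤m)))
  ... | suc (suc zero) = refl
  ... | suc (suc (suc y)) = ⊥-elim (<-irrefl refl (subst (0 <_) d≡0 (*-monoʳ-< 2 (s≤s z≤n))))

  ∑defect≡2 : n % 2 ≡ 1 → sum (defect G) ≡ 2 → G ≃ M n ⊎ (n ≡ 5 × G ≃ H₁)
  ∑defect≡2 odd ∑≡2 with any? (λ v → codegree G v ≟ℕ 1)
  ... | yes (h , h≡1) = inj₂ (cong (λ k → suc (suc k)) m≡3 , hub-case m≡3)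
    where
    defect-h : defect G h ≡ m ∸ 1
    defect-h = cong (λ c → defectOf n (c ∸ 1)) h≡1
    m≡3 : m ≡ 3
    m≡3 = ≤-antisym (≤-trans (m≤n+m∸n m 1) (+-monoʳ-≤ 1 (subst (_≤ 2) defect-h (subst (defect G h ≤_) ∑≡2 (≤-sum (defect G) h)))))
                    (odd⇒3≤m m 2≤m odd)
    c≡2 : ∀ {v} → v ≢ h → codegree G v ≡ 2
    c≡2 v≢h = defect≡0⇒codegree≡2 (≡sum⇒≡0 (defect G) (trans defect-h (trans (cong (_∸ 1) m≡3) (sym ∑≡2))) v≢h)
    hub-case : m ≡ 3 → G ≃ H₁
    hub-case refl = HubCase.≃H₁ G h≡1 c≡2
  ... | no ∄c≡1 = inj₁ (codegree≡3⇒≃M G odd (s≤s z≤n) c≡3 c≡2)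
    where
    positive : ∃ λ v → 0 < defect G v
    positive = sum-pos (defect G) (subst (0 <_) (sym ∑≡2) (s≤s z≤n))
    v₀ : Fin n
    v₀ = proj₁ positive
    c≡3 : codegree G v₀ ≡ 3
    c≡3 with codegree G v₀ in c≡ | proj₂ positive | subst (defect G v₀ ≤_) ∑≡2 (≤-sum (defect G) v₀)
    ... | zero | _ | _ = ⊥-elim (<-irrefl refl (subst (1 ≤_) c≡ (1≤codegree G v₀)))
    ... | suc zero | _ | _ = ⊥-elim (∄c≡1 (v₀ , c≡))
    ... | suc (suc zero) | () | _
    ... | suc (suc (suc zero)) | _ | _ = refl
    ... | suc (suc (suc (suc y))) | _ | d≤2 with ≤-trans (*-monoʳ-≤ 2 (s≤s (s≤s z≤n))) d≤2
    ...   | s≤s (s≤s ())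
    c≡2 : ∀ {v} → v ≢ v₀ → codegree G v ≡ 2
    c≡2 v≢v₀ = defect≡0⇒codegree≡2 (≡sum⇒≡0 (defect G) (trans (cong (λ c → defectOf n (c ∸ 1)) c≡3) (sym ∑≡2)) v≢v₀)

  ∑defect-tight : sum (defect G) ≡ 2 * (n % 2) → G ≃ M n ⊎ (n ≡ 5 × G ≃ H₁)
  ∑defect-tight ∑≡ with %2≡0⊎%2≡1 n
  ... | inj₁ even = inj₁ (codegree≡2⇒≃M G even λ v → defect≡0⇒codegree≡2 (sum≡0⇒≡0 (defect G) (trans ∑≡ (cong (2 *_) even)) v))
  ... | inj₂ odd = ∑defect≡2 odd (trans ∑≡ (cong (2 *_) odd))

∑defect-extremal : ∀ {k} (G : Graph (suc k)) → 1 ≤ k → G ≃ M (suc k) ⊎ (suc k ≡ 5 × G ≃ H₁) → sum (defect G) ≡ 2 * (suc k % 2)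
∑defect-extremal G 1≤k (inj₁ G≃M) = trans (∑defect-≃ G≃M) (∑defect-M 1≤k)
∑defect-extremal G 1≤k (inj₂ (refl , G≃H₁)) = ∑defect-≃ G≃H₁

+≡⇒≤∸ : ∀ {a d t b} → a + d ≡ t → b ≤ d → a ≤ t ∸ b
+≡⇒≤∸ {a} {d} {t} {b} a+d≡t b≤d = subst (_≤ t ∸ b) (trans (cong (_∸ d) (sym a+d≡t)) (m+n∸n≡m a d)) (∸-monoʳ-≤ t b≤d)

+≡⇒[≡∸⇔≡] : ∀ {a d t b} → a + d ≡ t → b ≤ t → (a ≡ t ∸ b) ⇔ (d ≡ b)
+≡⇒[≡∸⇔≡] {a} {d} {t} {b} a+d≡t b≤t = mk⇔
  (λ a≡ → trans (sym (trans (cong (_∸ a) (sym a+d≡t)) (m+n∸m≡n a d))) (trans (cong (t ∸_) a≡) (m∸[m∸n]≡n b≤t)))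
  (λ d≡b → trans (sym (trans (cong (_∸ d) (sym a+d≡t)) (m+n∸n≡m a d))) (cong (t ∸_) d≡b))

2n²-4n≡n*2m : ∀ m → 2 * suc (suc m) * suc (suc m) ∸ 4 * suc (suc m) ≡ suc (suc m) * (2 * m)
2n²-4n≡n*2m m = trans (cong (_∸ 4 * suc (suc m)) (expand m)) (m+n∸n≡m (suc (suc m) * (2 * m)) (4 * suc (suc m)))
  where
  expand : ∀ m → 2 * suc (suc m) * suc (suc m) ≡ suc (suc m) * (2 * m) + 4 * suc (suc m)
  expand = solve-∀

theorem3 : (n : ℕ) → 4 ≤ n → (G : Graph n) → Connected G → diameter G ≡ 2 →
    (ξᶜ G ≤ 2 * n * n ∸ 4 * n ∸ 2 * (n % 2))
    × (ξᶜ G ≡ 2 * n * n ∸ 4 * n ∸ 2 * (n % 2) ⇔ (G ≃ M n ⊎ (n ≡ 5 × G ≃ H₁)))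
theorem3 (suc (suc m)) (s≤s (s≤s 2≤m)) G _ diam =
  +≡⇒≤∸ ξ+∑≡ lower ,
  mk⇔ (∑defect-tight G 2≤m ∘ Equivalence.to ξ≡⇔∑≡) (Equivalence.from ξ≡⇔∑≡ ∘ ∑defect-extremal G (s≤s z≤n))
  where
  ξ+∑≡ : ξᶜ G + sum (defect G) ≡ 2 * suc (suc m) * suc (suc m) ∸ 4 * suc (suc m)
  ξ+∑≡ = trans (ξᶜ+∑defect G diam (≤-trans (s≤s z≤n) 2≤m)) (sym (2n²-4n≡n*2m m))
  lower : 2 * (suc (suc m) % 2) ≤ sum (defect G)
  lower = ∑defect-lower G 2≤m
  ξ≡⇔∑≡ : (ξᶜ G ≡ 2 * suc (suc m) * suc (suc m) ∸ 4 * suc (suc m) ∸ 2 * (suc (suc m) % 2)) ⇔ (sum (defect G) ≡ 2 * (suc (suc m) % 2))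
  ξ≡⇔∑≡ = +≡⇒[≡∸⇔≡] ξ+∑≡ (≤-trans lower (subst (sum (defect G) ≤_) ξ+∑≡ (m≤n+m (sum (defect G)) (ξᶜ G))))
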